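{- Let $\rho=l\to r$ be a linear term rewrite rule over a signature $\Sigma$ and let $s$ be a linear term. If $s^\circ\Rightarrow G$ via $\rho^\circ$, then $G\cong t^\circ$ for some term $t$ with $s\to t$ (via $\rho$).
   Context: Terms over signature $\Sigma$ (arities $\#$) and variables $\mathcal{X}$; linear = each variable at most once; positions: sequences of positive integers. A rule $l\to r$ has $l\notin\mathcal{X}$, $\mathrm{Var}(r)\subseteq\mathrm{Var}(l)$; linear if $l,r$ linear. $s\to t$ via $\rho$ iff $s=C[l\sigma]$, $t=C[r\sigma]$ for a context $C$ and substitution $\sigma$. $\mathbf{Graph}(\Sigma^\circ)$: graphs with labels in the flat lattice $\Sigma^\circ=(\Sigma\uplus\mathbb{N}^+)\uplus\{\bot,\top\}$ ($\bot$ least, $\top$ greatest, others incomparable); morphisms commute with source/target and satisfy $\ell(x)\le\ell(\phi(x))$. PBPO$^+$: a rule is $L,K,R,L',K'$ with $l:K\to L$, $r:K\to R$, $l':K'\to L'$, monos $t_L:L\rightarrowtail L'$, $t_K:K\rightarrowtail K'$, $t_L\circ l=l'\circ t_K$ a pullback. A step $G_L\Rightarrow G_R$: a mono $m:L\rightarrowtail G_L$ and $\alpha:G_L\to L'$ with $\alpha\circ m=t_L$ and ($L$, $1_L$, $m$) a pullback of $t_L,\alpha$; $(G_K,g_L,u')$ a pullback of $\alpha,l'$; $u:K\to G_K$ the unique morphism with $u'\circ u=t_K$, $g_L\circ u=m\circ l$; $G_R$ a pushout of $u$ and $r$. Encodings: $t^\circ$ has a vertex $p$ labeled $f$ per position $p$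 holding symbol $f$, a vertex $x$ labeled $\bot$ per variable $x$ of $t$, and an edge labeled $i$ from the vertex at $p$ to the vertex at $pi$; root at $\epsilon$. The context closure $\mathcal{C}[G{\downarrow_\mathcal{X}}]$ of a rooted graph: relabel each variable vertex $x$ to $\top$ and add a fresh $\top$-vertex $x'$ with $\top$-edges $x\to x'$, $x'\to x'$; add a fresh $\top$-vertex $\mathcal{C}$ with $\top$-edges $\mathcal{C}\to$ root and $\mathcal{C}\to\mathcal{C}$. $\mathcal{I}(r)$: discrete graph on $\mathrm{Var}(r)\cup\{\epsilon\}$ labeled $\bot$, root $\epsilon$. $\rho^\circ$: $L=l^\circ$, $K=\mathcal{I}(r)$, $R=r^\circ$, $L'=\mathcal{C}[l^\circ{\downarrow_\mathcal{X}}]$, $K'=\mathcal{C}[\mathcal{I}(r){\downarrow_\mathcal{X}}]$; $l,r,l',t_L,t_K$ map roots to roots and are inclusions otherwise. -}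

module Defs where

open import Level using (Level) renaming (suc to lsuc; zero to lzero)
open import Data.Nat using (ℕ; zero; suc; _≤_; _≡ᵇ_; _+_)
open import Data.Nat.Properties using (≡⇒≡ᵇ)
open import Data.Bool using (Bool; true; false; T; if_then_else_; _∨_)
open import Data.Bool.Properties using (T-∨)
open import Data.Fin using (Fin)
open import Data.Vec using (Vec; []; _∷_; _[_]≔_)
open import Data.List using (List; []; _∷_; _++_; [_])
open import Data.Maybe using (Maybe; just; nothing; is-just)
open import Data.Product using (Σ; _×_; _,_; ∃; proj₁; proj₂)
open import Data.Sum using (_⊎_; inj₁; inj₂)
open import Data.Unit using (⊤; tt)
open import Data.Empty using (⊥-elim) renaming (⊥ to Empty)
open import Function using (_∘_; id)
open import Function.Bundles using (Equivalence)
open import Relation.Binary.PropositionalEquality using (_≡_; refl; sym; trans; cong; subst)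

record Signature : Set₁ where
  field
    Sym   : Set
    arity : Sym → ℕ

module TRS (S : Signature) where
  open Signature S

  Var : Set
  Var = ℕ

  data Term : Set where
    var : Var → Term
    fun : (f : Sym) → Vec Term (arity f) → Term

  mutual
    count : Var → Term → ℕ
    count x (var y)    = if x ≡ᵇ y then 1 else 0
    count x (fun f ts) = countArgs x ts

    countArgs : ∀ {n} → Var → Vec Term n → ℕ
    countArgs x []       = 0
    countArgs x (t ∷ ts) = count x t + countArgs x ts

  mutual
    occurs : Var → Term → Bool
    occurs x (var y)    = x ≡ᵇ y
    occurs x (fun f ts) = occursArgs x ts

    occursArgs : ∀ {n} → Var → Vec Term n → Bool
    occursArgs x []       = false
    occursArgs x (t ∷ ts) = occurs x t ∨ occursArgs x ts

  Linear : Term → Set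
  Linear t = ∀ x → count x t ≤ 1

  _⊆V_ : Term → Term → Set
  r ⊆V l = ∀ x → T (occurs x r) → T (occurs x l)

  Subst : Set
  Subst = Var → Term

  mutual
    _⟨_⟩ : Term → Subst → Term
    var x ⟨ σ ⟩    = σ x
    fun f ts ⟨ σ ⟩ = fun f (substArgs ts σ)

    substArgs : ∀ {n} → Vec Term n → Subst → Vec Term n
    substArgs []       σ = []
    substArgs (t ∷ ts) σ = (t ⟨ σ ⟩) ∷ substArgs ts σ

  data Ctx : Set where
    □   : Ctx
    arg : (f : Sym) (i : Fin (arity f)) (ts : Vec Term (arity f)) → Ctx → Ctx

  plug : Ctx → Term → Term
  plug □ u              = u
  plug (arg f i ts C) u = fun f (ts [ i ]≔ plug C u)

  NonVar : Term → Set
  NonVar (var _)   = Empty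
  NonVar (fun _ _) = ⊤

  record Rule : Set where
    constructor _⇒_∣_∣_
    field
      lhs  : Term
      rhs  : Term
      lhs-nonvar : NonVar lhs
      vars⊆      : rhs ⊆V lhs

  _⟶[_]_ : Term → Rule → Term → Set
  s ⟶[ ρ ] t = Σ Ctx λ C → Σ Subst λ σ →
                 (s ≡ plug C (Rule.lhs ρ ⟨ σ ⟩)) × (t ≡ plug C (Rule.rhs ρ ⟨ σ ⟩))

  -- Positions.  A position is a list of argument indices; CONVENTION:
  -- the entry j encodes the positive integer j+1 (i.e. the (j+1)-th argument).

  Pos : Set
  Pos = List ℕ

  mutual
    subtermAt : Term → Pos → Maybe Term
    subtermAt t []                = just t
    subtermAt (var x) (j ∷ p)     = nothing
    subtermAt (fun f ts) (j ∷ p)  = argAt ts j p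

    argAt : ∀ {n} → Vec Term n → ℕ → Pos → Maybe Term
    argAt []       j       p = nothing
    argAt (t ∷ ts) zero    p = subtermAt t p
    argAt (t ∷ ts) (suc j) p = argAt ts j p

  funM : Maybe Term → Maybe Sym
  funM (just (fun f _)) = just f
  funM _                = nothing

  isPos : Term → Pos → Bool
  isPos t p = is-just (subtermAt t p)

  isFun : Term → Pos → Bool
  isFun t p = is-just (funM (subtermAt t p))

  symOf : (m : Maybe Sym) → T (is-just m) → Sym
  symOf (just f) _ = f

  mutual
    occ-at : (t : Term) (q : Pos) (x : Var) → subtermAt t q ≡ just (var x) → T (occurs x t)
    occ-at (var y) [] x refl = ≡⇒≡ᵇ x x refl
    occ-at (var y) (j ∷ q) x ()
    occ-at (fun f ts) [] x ()
    occ-at (fun f ts) (j ∷ q) x eq = occ-args ts j q x eq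

    occ-args : ∀ {n} (ts : Vec Term n) (j : ℕ) (q : Pos) (x : Var) →
               argAt ts j q ≡ just (var x) → T (occursArgs x ts)
    occ-args [] j q x ()
    occ-args (t ∷ ts) zero q x eq    = Equivalence.from T-∨ (inj₁ (occ-at t q x eq))
    occ-args (t ∷ ts) (suc j) q x eq = Equivalence.from T-∨ (inj₂ (occ-args ts j q x eq))

  -- The flat lattice Σ° = (Σ ⊎ ℕ⁺) ⊎ {⊥, ⊤}
  -- CONVENTION: num n denotes the positive integer n+1.

  data Lab : Set where
    sy   : Sym → Lab
    num  : ℕ → Lab
    bot  : Lab
    top  : Lab

  data _≤L_ : Lab → Lab → Set where
    bot≤  : ∀ {a} → bot ≤L a
    ≤top  : ∀ {a} → a ≤L top
    refl≤ : ∀ {a} → a ≤L a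

  ≤L-trans : ∀ {a b c} → a ≤L b → b ≤L c → a ≤L c
  ≤L-trans bot≤ _     = bot≤
  ≤L-trans ≤top ≤top  = ≤top
  ≤L-trans ≤top refl≤ = ≤top
  ≤L-trans refl≤ q    = q

  record Graph : Set₁ where
    field
      V E  : Set
      src tgt : E → V
      lV : V → Lab
      lE : E → Lab

  open Graph public

  record Hom (G H : Graph) : Set where
    field
      hV : V G → V H
      hE : E G → E H
      h-src : ∀ e → hV (src G e) ≡ src H (hE e)
      h-tgt : ∀ e → hV (tgt G e) ≡ tgt H (hE e)
      h-lV  : ∀ v → lV G v ≤L lV H (hV v)
      h-lE  : ∀ e → lE G e ≤L lE H (hE e)

  open Hom public

  idH : ∀ {G} → Hom G G
  idH = record { hV = id ; hE = id ; h-src = λ _ → refl ; h-tgt = λ _ → refl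
               ; h-lV = λ _ → refl≤ ; h-lE = λ _ → refl≤ }

  _∘H_ : ∀ {A B C} → Hom B C → Hom A B → Hom A C
  g ∘H f = record
    { hV = hV g ∘ hV f ; hE = hE g ∘ hE f
    ; h-src = λ e → trans (cong (hV g) (h-src f e)) (h-src g (hE f e))
    ; h-tgt = λ e → trans (cong (hV g) (h-tgt f e)) (h-tgt g (hE f e))
    ; h-lV  = λ v → ≤L-trans (h-lV f v) (h-lV g (hV f v))
    ; h-lE  = λ e → ≤L-trans (h-lE f e) (h-lE g (hE f e)) }

  _≈H_ : ∀ {A B} → Hom A B → Hom A B → Set
  f ≈H g = (∀ v → hV f v ≡ hV g v) × (∀ e → hE f e ≡ hE g e)

  IsMono : ∀ {A B} → Hom A B → Set₁
  IsMono {A} {B} m = ∀ (X : Graph) (f g : Hom X A) → (m ∘H f) ≈H (m ∘H g) → f ≈H g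

  record IsPullback {A B C P : Graph} (f : Hom A C) (g : Hom B C)
                    (p₁ : Hom P A) (p₂ : Hom P B) : Set₁ where
    field
      commutes  : (f ∘H p₁) ≈H (g ∘H p₂)
      universal : ∀ (X : Graph) (q₁ : Hom X A) (q₂ : Hom X B) → (f ∘H q₁) ≈H (g ∘H q₂) →
                  Σ (Hom X P) λ u → ((p₁ ∘H u) ≈H q₁) × ((p₂ ∘H u) ≈H q₂) ×
                    (∀ (w : Hom X P) → (p₁ ∘H w) ≈H q₁ → (p₂ ∘H w) ≈H q₂ → w ≈H u)

  record IsPushout {A B C Q : Graph} (f : Hom C A) (g : Hom C B)
                   (i₁ : Hom A Q) (i₂ : Hom B Q) : Set₁ where
    field
      commutes  : (i₁ ∘H f) ≈H (i₂ ∘H g)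
      universal : ∀ (X : Graph) (q₁ : Hom A X) (q₂ : Hom B X) → (q₁ ∘H f) ≈H (q₂ ∘H g) →
                  Σ (Hom Q X) λ u → ((u ∘H i₁) ≈H q₁) × ((u ∘H i₂) ≈H q₂) ×
                    (∀ (w : Hom Q X) → (w ∘H i₁) ≈H q₁ → (w ∘H i₂) ≈H q₂ → w ≈H u)

  record _≅_ (G H : Graph) : Set where
    field
      to   : Hom G H
      from : Hom H G
      from∘to : (from ∘H to) ≈H idH
      to∘from : (to ∘H from) ≈H idH

  record PRule : Set₁ where
    field
      L K R L' K' : Graph
      l  : Hom K L
      r  : Hom K R
      l' : Hom K' L'
      tL : Hom L L'
      tK : Hom K K'
      tL-mono : IsMono tL
      tK-mono : IsMono tK

  record Step (ρ : PRule) (GL GR : Graph) : Set₁ where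
    open PRule ρ
    field
      m      : Hom L GL
      m-mono : IsMono m
      α      : Hom GL L'
      α∘m    : (α ∘H m) ≈H tL
      pb₁    : IsPullback tL α idH m
      GK     : Graph
      gL     : Hom GK GL
      u'     : Hom GK K'
      pb₂    : IsPullback α l' gL u'
      u      : Hom K GK
      u-tK   : (u' ∘H u) ≈H tK
      u-l    : (gL ∘H u) ≈H (m ∘H l)
      gR     : Hom GK GR
      n      : Hom R GR
      po     : IsPushout u r gR n

  record RGraph : Set₁ where
    field
      gr    : Graph
      root  : V gr
      isVar : V gr → Bool

  open RGraph public

  FunPos : Term → Set
  FunPos t = Σ Pos λ p → T (isFun t p)

  VarOf : Term → Set
  VarOf t = Σ Var λ x → T (occurs x t)

  TV : Term → Set
  TV t = FunPos t ⊎ VarOf t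

  vAt : (t : Term) (q : Pos) (mt : Maybe Term) → subtermAt t q ≡ mt → T (is-just mt) → TV t
  vAt t q (just (var x))    eq _ = inj₂ (x , occ-at t q x eq)
  vAt t q (just (fun f us)) eq _ = inj₁ (q , subst (T ∘ is-just ∘ funM) (sym eq) tt)

  vertexAt : (t : Term) (q : Pos) → T (isPos t q) → TV t
  vertexAt t q h = vAt t q (subtermAt t q) refl h

  TE : Term → Set
  TE t = Σ Pos λ p → Σ ℕ λ j → T (isFun t p) × T (isPos t (p ++ [ j ]))

  isVarTV : ∀ {t} → TV t → Bool
  isVarTV (inj₁ _) = false
  isVarTV (inj₂ _) = true

  enc : Term → RGraph
  enc t = record
    { gr = record
        { V = TV t ; E = TE t
        ; src = λ { (p , j , a , b) → inj₁ (p , a) }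
        ; tgt = λ { (p , j , a , b) → vertexAt t (p ++ [ j ]) b }
        ; lV = λ { (inj₁ (p , a)) → sy (symOf (funM (subtermAt t p)) a)
                 ; (inj₂ _) → bot }
        ; lE = λ { (p , j , a , b) → num j } }
    ; root = vertexAt t [] tt
    ; isVar = isVarTV }

  _° : Term → Graph
  t ° = gr (enc t)

  -- 𝓘(r): discrete graph on Var(r) ∪ {ε}, all labelled ⊥, root ε
  disc : Term → RGraph
  disc r = record
    { gr = record
        { V = ⊤ ⊎ VarOf r ; E = Empty
        ; src = λ () ; tgt = λ () ; lV = λ _ → bot ; lE = λ () }
    ; root = inj₁ tt
    ; isVar = λ { (inj₁ _) → false ; (inj₂ _) → true } }

  module _ (G : RGraph) where
    data CV : Set where
      old  : V (gr G) → CV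
      prm  : (v : V (gr G)) → T (isVar G v) → CV
      ctxV : CV

    data CE : Set where
      oldE   : E (gr G) → CE
      toPrm  : (v : V (gr G)) → T (isVar G v) → CE
      prmLp  : (v : V (gr G)) → T (isVar G v) → CE
      toRoot : CE
      ctxLp  : CE

  closure : RGraph → Graph
  closure G = record
    { V = CV G ; E = CE G
    ; src = λ { (oldE e) → old (src (gr G) e) ; (toPrm v p) → old v ; (prmLp v p) → prm v p
              ; toRoot → ctxV ; ctxLp → ctxV }
    ; tgt = λ { (oldE e) → old (tgt (gr G) e) ; (toPrm v p) → prm v p ; (prmLp v p) → prm v p
              ; toRoot → old (root G) ; ctxLp → ctxV }
    ; lV = λ { (old v) → if isVar G v then top else lV (gr G) v ; (prm v p) → top ; ctxV → top }
    ; lE = λ { (oldE e) → lE (gr G) e ; _ → top } }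

  incl : (G : RGraph) → Hom (gr G) (closure G)
  incl G = record
    { hV = old ; hE = oldE ; h-src = λ _ → refl ; h-tgt = λ _ → refl
    ; h-lV = lem ; h-lE = λ _ → refl≤ }
    where
      lem : ∀ v → lV (gr G) v ≤L lV (closure G) (old v)
      lem v with isVar G v
      ... | true  = ≤top
      ... | false = refl≤

  closeHom : (G H : RGraph) (h : Hom (gr G) (gr H)) → hV h (root G) ≡ root H →
             (∀ v → T (isVar G v) → T (isVar H (hV h v))) → Hom (closure G) (closure H)
  closeHom G H h hr hvar = record
    { hV = fV ; hE = fE ; h-src = s ; h-tgt = t ; h-lV = lv ; h-lE = le }
    where
      fV : CV G → CV H
      fV (old v)   = old (hV h v)
      fV (prm v p) = prm (hV h v) (hvar v p)
      fV ctxV      = ctxV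
      fE : CE G → CE H
      fE (oldE e)    = oldE (hE h e)
      fE (toPrm v p) = toPrm (hV h v) (hvar v p)
      fE (prmLp v p) = prmLp (hV h v) (hvar v p)
      fE toRoot      = toRoot
      fE ctxLp       = ctxLp
      s : ∀ e → fV (src (closure G) e) ≡ src (closure H) (fE e)
      s (oldE e)    = cong old (h-src h e)
      s (toPrm v p) = refl
      s (prmLp v p) = refl
      s toRoot      = refl
      s ctxLp       = refl
      t : ∀ e → fV (tgt (closure G) e) ≡ tgt (closure H) (fE e)
      t (oldE e)    = cong old (h-tgt h e)
      t (toPrm v p) = refl
      t (prmLp v p) = refl
      t toRoot      = cong old hr
      t ctxLp       = refl
      lvOld : ∀ v (b c : Bool) → isVar G v ≡ b → isVar H (hV h v) ≡ c →
              (if b then top else lV (gr G) v) ≤L (if c then top else lV (gr H) (hV h v))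
      lvOld v true  true  _ _ = refl≤
      lvOld v true  false e₁ e₂ = ⊥-elim (subst T e₂ (hvar v (subst T (sym e₁) tt)))
      lvOld v false true  _ _ = ≤top
      lvOld v false false _ _ = h-lV h v
      lv : ∀ x → lV (closure G) x ≤L lV (closure H) (fV x)
      lv (old v)   = lvOld v (isVar G v) (isVar H (hV h v)) refl refl
      lv (prm v p) = refl≤
      lv ctxV      = refl≤
      le : ∀ e → lE (closure G) e ≤L lE (closure H) (fE e)
      le (oldE e)    = h-lE h e
      le (toPrm v p) = refl≤
      le (prmLp v p) = refl≤
      le toRoot      = refl≤
      le ctxLp       = refl≤

  lMor : (ρ : Rule) → Hom (gr (disc (Rule.rhs ρ))) (Rule.lhs ρ °)
  lMor ρ = record
    { hV = λ { (inj₁ _) → root (enc (Rule.lhs ρ))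
             ; (inj₂ (x , p)) → inj₂ (x , Rule.vars⊆ ρ x p) }
    ; hE = λ () ; h-src = λ () ; h-tgt = λ () ; h-lV = λ _ → bot≤ ; h-lE = λ () }

  rMor : (ρ : Rule) → Hom (gr (disc (Rule.rhs ρ))) (Rule.rhs ρ °)
  rMor ρ = record
    { hV = λ { (inj₁ _) → root (enc (Rule.rhs ρ)) ; (inj₂ (x , p)) → inj₂ (x , p) }
    ; hE = λ () ; h-src = λ () ; h-tgt = λ () ; h-lV = λ _ → bot≤ ; h-lE = λ () }

  lMor-var : (ρ : Rule) → ∀ v → T (isVar (disc (Rule.rhs ρ)) v) →
             T (isVar (enc (Rule.lhs ρ)) (hV (lMor ρ) v))
  lMor-var ρ (inj₂ _) _ = tt

  incl-mono : (G : RGraph) → IsMono (incl G)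
  incl-mono G X f g (eV , eE) = (λ v → old-inj (eV v)) , (λ e → oldE-inj (eE e))
    where
      old-inj : ∀ {a b} → CV.old {G} a ≡ old b → a ≡ b
      old-inj refl = refl
      oldE-inj : ∀ {a b} → CE.oldE {G} a ≡ oldE b → a ≡ b
      oldE-inj refl = refl

  _°R : Rule → PRule
  ρ °R = record
    { L  = Rule.lhs ρ °
    ; K  = gr (disc (Rule.rhs ρ))
    ; R  = Rule.rhs ρ °
    ; L' = closure (enc (Rule.lhs ρ))
    ; K' = closure (disc (Rule.rhs ρ))
    ; l  = lMor ρ
    ; r  = rMor ρ
    ; l' = closeHom (disc (Rule.rhs ρ)) (enc (Rule.lhs ρ)) (lMor ρ) refl (lMor-var ρ)
    ; tL = incl (enc (Rule.lhs ρ))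
    ; tK = incl (disc (Rule.rhs ρ))
    ; tL-mono = incl-mono (enc (Rule.lhs ρ))
    ; tK-mono = incl-mono (disc (Rule.rhs ρ)) }

{-# OPTIONS --safe #-}
module Submission where

-- Since α ∘ m = t_L and (L, 1, m) is a pullback, α sends the vertices matched by m to
-- l° and every other vertex of s° to a vertex added by the context closure; following
-- the edges of s° from its root shows that the context of the match goes to 𝒞 and
-- everything strictly below a matched variable x goes to x′.  Since m preserves edge
-- labels, it is the occurrence of l at some position p of s, so s|p = lσ for some σ; put
-- t = s[rσ]p, hence s → t.  The pullback G_K keeps the context, the root p and the
-- subterms σ(x) below the variables, and the pushout glues r° onto it along 𝓘(r).
-- Translating positions of s into positions of t gives a cocone G_K → t° ← r°, hence
-- G → t°, and the same case analysis on positions of t gives its inverse; linearity of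
-- s, l and r makes all variable positions unique, which is what makes these maps
-- well defined and mutually inverse.

open import Defs
open import Data.Nat using (ℕ; zero; suc; _≤_; _≡ᵇ_; _+_; z≤n; s≤s; _<_; _<?_; _≟_)
open import Data.Nat.Properties using (≡ᵇ⇒≡; ≤-trans; +-mono-≤; m≤m+n; m≤n+m)
open import Data.Bool using (Bool; true; false; T; if_then_else_)
open import Data.Bool.Properties using (T-irrelevant)
open import Data.Fin using (fromℕ<)
open import Data.Vec using (Vec; []; _∷_; _[_]≔_; lookup)
open import Data.List using (List; []; _∷_; _++_; [_])
open import Data.List.Properties using (++-assoc; ++-identityʳ; ++-conicalʳ; ∷-injective)
open import Data.List.Reverse using (Reverse; reverseView; []; _∶_∶ʳ_)
open import Data.Maybe using (Maybe; just; nothing; is-just; fromMaybe) renaming (map to mapM)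
open import Data.Maybe.Properties using (just-injective)
open import Data.Product using (Σ; _×_; _,_; proj₁; proj₂)
open import Data.Sum using (_⊎_; inj₁; inj₂)
open import Data.Unit using (⊤; tt)
open import Data.Empty using (⊥-elim) renaming (⊥ to Empty)
open import Function using (_∘_)
open import Relation.Binary.PropositionalEquality using (_≡_; _≢_; refl; sym; trans; cong; cong₂; subst)
open import Relation.Nullary using (Dec; yes; no)

snoc-induction : ∀ {A : Set} (P : List A → Set) → P [] → (∀ q j → P q → P (q ++ [ j ])) → ∀ q → P q
snoc-induction P base step q = go (reverseView q)
  where
    go : ∀ {q} → Reverse q → P q
    go []            = base
    go (q ∶ r ∶ʳ j)  = step q j (go r)

stripPrefix : List ℕ → List ℕ → Maybe (List ℕ)
stripPrefix []      q       = just q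
stripPrefix (i ∷ p) []      = nothing
stripPrefix (i ∷ p) (j ∷ q) with i ≟ j
... | yes _ = stripPrefix p q
... | no  _ = nothing

stripPrefix-++ : ∀ p r → stripPrefix p (p ++ r) ≡ just r
stripPrefix-++ []      r = refl
stripPrefix-++ (i ∷ p) r with i ≟ i
... | yes _  = stripPrefix-++ p r
... | no i≢i = ⊥-elim (i≢i refl)

stripPrefix-just : ∀ p q {r} → stripPrefix p q ≡ just r → q ≡ p ++ r
stripPrefix-just []      q       refl = refl
stripPrefix-just (i ∷ p) []      ()
stripPrefix-just (i ∷ p) (j ∷ q) e with i ≟ j
... | yes refl = cong (i ∷_) (stripPrefix-just p q e)
stripPrefix-just (i ∷ p) (j ∷ q) () | no _

stripPrefix-self : ∀ p → stripPrefix p p ≡ just []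
stripPrefix-self p = trans (cong (stripPrefix p) (sym (++-identityʳ p))) (stripPrefix-++ p [])

stripPrefix-snoc : ∀ p q j {r} → stripPrefix p q ≡ just r → stripPrefix p (q ++ [ j ]) ≡ just (r ++ [ j ])
stripPrefix-snoc p q j {r} e rewrite stripPrefix-just p q e | ++-assoc p r [ j ] = stripPrefix-++ p (r ++ [ j ])

stripPrefix-parent : ∀ p q j → stripPrefix p (q ++ [ j ]) ≡ nothing → stripPrefix p q ≡ nothing
stripPrefix-parent p q j e with stripPrefix p q in eq
... | nothing = refl
... | just r with trans (sym (stripPrefix-snoc p q j eq)) e
... | ()

snoc≡++⇒ : ∀ (p q : List ℕ) j r → q ++ [ j ] ≡ p ++ r → (r ≡ []) ⊎ (Σ (List ℕ) λ z → q ≡ p ++ z)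
snoc≡++⇒ []      q       j r e = inj₂ (q , refl)
snoc≡++⇒ (i ∷ p) []      j r e = inj₁ (++-conicalʳ p r (sym (proj₂ (∷-injective e))))
snoc≡++⇒ (i ∷ p) (k ∷ q) j r e with ∷-injective e
... | refl , e′ with snoc≡++⇒ p q j r e′
...   | inj₁ r≡[]       = inj₁ r≡[]
...   | inj₂ (z , q≡pz) = inj₂ (z , cong (i ∷_) q≡pz)

stripPrefix-enter : ∀ p q j {r} → stripPrefix p q ≡ nothing → stripPrefix p (q ++ [ j ]) ≡ just r → q ++ [ j ] ≡ p
stripPrefix-enter p q j {r} out inside with snoc≡++⇒ p q j r (stripPrefix-just p (q ++ [ j ]) inside)
... | inj₁ refl = trans (stripPrefix-just p (q ++ [ j ]) inside) (++-identityʳ p)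
... | inj₂ (z , refl) with trans (sym (stripPrefix-++ p z)) out
... | ()

++-assoc₃ : ∀ {A : Set} (a b r : List A) j → (a ++ b ++ r) ++ [ j ] ≡ a ++ b ++ (r ++ [ j ])
++-assoc₃ a b r j = trans (++-assoc a (b ++ r) [ j ]) (cong (a ++_) (++-assoc b r [ j ]))

≡ᵇ-refl : ∀ i → (i ≡ᵇ i) ≡ true
≡ᵇ-refl zero    = refl
≡ᵇ-refl (suc i) = ≡ᵇ-refl i

+-positive≰1 : ∀ {a b} → 1 ≤ a → 1 ≤ b → a + b ≤ 1 → Empty
+-positive≰1 1≤a 1≤b a+b≤1 with ≤-trans (+-mono-≤ 1≤a 1≤b) a+b≤1
... | s≤s ()

+≤1ˡ : ∀ a b → a + b ≤ 1 → a ≤ 1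
+≤1ˡ a b = ≤-trans (m≤m+n a b)

+≤1ʳ : ∀ a b → a + b ≤ 1 → b ≤ 1
+≤1ʳ a b = ≤-trans (m≤n+m b a)

module Positions (S : Signature) where
  open Signature S
  open TRS S

  mutual
    subtermAt-++ : ∀ t p q {u} → subtermAt t p ≡ just u → subtermAt t (p ++ q) ≡ subtermAt u q
    subtermAt-++ t [] q refl = refl
    subtermAt-++ (var x) (j ∷ p) q ()
    subtermAt-++ (fun f ts) (j ∷ p) q e = argAt-++ ts j p q e

    argAt-++ : ∀ {n} (ts : Vec Term n) j p q {u} → argAt ts j p ≡ just u → argAt ts j (p ++ q) ≡ subtermAt u q
    argAt-++ [] j p q ()
    argAt-++ (t ∷ ts) zero p q e = subtermAt-++ t p q e
    argAt-++ (t ∷ ts) (suc j) p q e = argAt-++ ts j p q e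

  mutual
    subtermAt-++-nothing : ∀ t p q → subtermAt t p ≡ nothing → subtermAt t (p ++ q) ≡ nothing
    subtermAt-++-nothing t [] q ()
    subtermAt-++-nothing (var x) (j ∷ p) q e = refl
    subtermAt-++-nothing (fun f ts) (j ∷ p) q e = argAt-++-nothing ts j p q e

    argAt-++-nothing : ∀ {n} (ts : Vec Term n) j p q → argAt ts j p ≡ nothing → argAt ts j (p ++ q) ≡ nothing
    argAt-++-nothing [] j p q e = refl
    argAt-++-nothing (t ∷ ts) zero p q e = subtermAt-++-nothing t p q e
    argAt-++-nothing (t ∷ ts) (suc j) p q e = argAt-++-nothing ts j p q e

  parent-is-fun : ∀ t q j → T (isPos t (q ++ [ j ])) → Σ Sym λ f → Σ (Vec Term (arity f)) λ us → subtermAt t q ≡ just (fun f us)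
  parent-is-fun t q j h with subtermAt t q in e
  ... | just (fun f us) = f , us , refl
  ... | just (var x) rewrite subtermAt-++ t q [ j ] e = ⊥-elim h
  ... | nothing rewrite subtermAt-++-nothing t q [ j ] e = ⊥-elim h

  isFun-intro : ∀ t q {f us} → subtermAt t q ≡ just (fun f us) → T (isFun t q)
  isFun-intro t q e rewrite e = tt

  isPos-intro : ∀ t q {u} → subtermAt t q ≡ just u → T (isPos t q)
  isPos-intro t q e rewrite e = tt

  isFun-elim : ∀ t q → T (isFun t q) → Σ Sym λ f → Σ (Vec Term (arity f)) λ us → subtermAt t q ≡ just (fun f us)
  isFun-elim t q h with subtermAt t q
  ... | just (fun f us) = f , us , refl
  ... | just (var x) = ⊥-elim h
  ... | nothing = ⊥-elim h

  isPos-elim : ∀ t q → T (isPos t q) → Σ Term λ u → subtermAt t q ≡ just u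
  isPos-elim t q h with subtermAt t q
  ... | just u = u , refl
  ... | nothing = ⊥-elim h

  bump : Pos → Pos
  bump [] = []
  bump (j ∷ q) = suc j ∷ q

  mutual
    varPos : Term → Var → Pos
    varPos (var y) x = []
    varPos (fun f ts) x = varPosArgs ts x

    varPosArgs : ∀ {n} → Vec Term n → Var → Pos
    varPosArgs [] x = []
    varPosArgs (t ∷ ts) x = if occurs x t then zero ∷ varPos t x else bump (varPosArgs ts x)

  mutual
    subtermAt-varPos : ∀ t x → T (occurs x t) → subtermAt t (varPos t x) ≡ just (var x)
    subtermAt-varPos (var y) x o rewrite ≡ᵇ⇒≡ x y o = refl
    subtermAt-varPos (fun f ts) x o with argAt-varPos ts x o
    ... | j , q , e1 , e2 rewrite e1 = e2

    argAt-varPos : ∀ {n} (ts : Vec Term n) x → T (occursArgs x ts) →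
                Σ ℕ λ j → Σ Pos λ q → (varPosArgs ts x ≡ j ∷ q) × (argAt ts j q ≡ just (var x))
    argAt-varPos [] x ()
    argAt-varPos (t ∷ ts) x o with occurs x t in eo
    ... | true = zero , varPos t x , refl , subtermAt-varPos t x (subst T (sym eo) tt)
    ... | false with argAt-varPos ts x o
    ... | j , q , e1 , e2 rewrite e1 = suc j , q , refl , e2

  mutual
    var⇒count≥1 : ∀ t q x → subtermAt t q ≡ just (var x) → 1 ≤ count x t
    var⇒count≥1 (var y) [] x refl rewrite ≡ᵇ-refl y = s≤s z≤n
    var⇒count≥1 (var y) (j ∷ q) x ()
    var⇒count≥1 (fun f ts) [] x ()
    var⇒count≥1 (fun f ts) (j ∷ q) x e = var⇒countArgs≥1 ts j q x e

    var⇒countArgs≥1 : ∀ {n} (ts : Vec Term n) j q x → argAt ts j q ≡ just (var x) → 1 ≤ countArgs x ts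
    var⇒countArgs≥1 [] j q x ()
    var⇒countArgs≥1 (t ∷ ts) zero q x e = ≤-trans (var⇒count≥1 t q x e) (m≤m+n (count x t) (countArgs x ts))
    var⇒countArgs≥1 (t ∷ ts) (suc j) q x e = ≤-trans (var⇒countArgs≥1 ts j q x e) (m≤n+m (countArgs x ts) (count x t))

  mutual
    var-position-unique : ∀ t x q q' → count x t ≤ 1 → subtermAt t q ≡ just (var x) → subtermAt t q' ≡ just (var x) → q ≡ q'
    var-position-unique (var y) x [] [] c e1 e2 = refl
    var-position-unique (var y) x [] (j ∷ q') c e1 ()
    var-position-unique (var y) x (j ∷ q) q' c () e2
    var-position-unique (fun f ts) x [] q' c () e2
    var-position-unique (fun f ts) x (j ∷ q) [] c e1 ()
    var-position-unique (fun f ts) x (j ∷ q) (j' ∷ q') c e1 e2 = argVar-position-unique ts x j j' q q' c e1 e2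

    argVar-position-unique : ∀ {n} (ts : Vec Term n) x j j' q q' → countArgs x ts ≤ 1 →
                             argAt ts j q ≡ just (var x) → argAt ts j' q' ≡ just (var x) → j ∷ q ≡ j' ∷ q'
    argVar-position-unique [] x j j' q q' c () e2
    argVar-position-unique (t ∷ ts) x zero zero q q' c e1 e2 = cong (zero ∷_) (var-position-unique t x q q' (+≤1ˡ (count x t) _ c) e1 e2)
    argVar-position-unique (t ∷ ts) x zero (suc j') q q' c e1 e2 = ⊥-elim (+-positive≰1 (var⇒count≥1 t q x e1) (var⇒countArgs≥1 ts j' q' x e2) c)
    argVar-position-unique (t ∷ ts) x (suc j) zero q q' c e1 e2 = ⊥-elim (+-positive≰1 (var⇒count≥1 t q' x e2) (var⇒countArgs≥1 ts j q x e1) c)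
    argVar-position-unique (t ∷ ts) x (suc j) (suc j') q q' c e1 e2 with argVar-position-unique ts x j j' q q' (+≤1ʳ (count x t) _ c) e1 e2
    ... | refl = refl

  linear-varPos : ∀ t → Linear t → ∀ x q → subtermAt t q ≡ just (var x) → q ≡ varPos t x
  linear-varPos t lin x q e = var-position-unique t x q (varPos t x) (lin x) e (subtermAt-varPos t x (occ-at t q x e))

  vertexPos : (t : Term) → TV t → Pos
  vertexPos t (inj₁ (q , _)) = q
  vertexPos t (inj₂ (x , _)) = varPos t x

  symOf-eq : ∀ (mt : Maybe Term) {f us} → mt ≡ just (fun f us) → (a : T (is-just (funM mt))) → symOf (funM mt) a ≡ f
  symOf-eq .(just (fun _ _)) refl a = refl

  vertexAt-irrelevant : ∀ t q (mt : Maybe Term) (e : subtermAt t q ≡ mt) h h' → vertexAt t q h ≡ vAt t q mt e h'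
  vertexAt-irrelevant t q .(subtermAt t q) refl h h' = cong (vAt t q (subtermAt t q) refl) (T-irrelevant h h')

  vertexAt-fun : ∀ t q {f us} → subtermAt t q ≡ just (fun f us) → ∀ h a → vertexAt t q h ≡ inj₁ (q , a)
  vertexAt-fun t q {f} {us} e h a rewrite vertexAt-irrelevant t q _ e h tt =
    cong (λ z → inj₁ (q , z)) (T-irrelevant _ a)

  vertexAt-var : ∀ t q {x} → subtermAt t q ≡ just (var x) → ∀ h o → vertexAt t q h ≡ inj₂ (x , o)
  vertexAt-var t q {x} e h o rewrite vertexAt-irrelevant t q _ e h tt =
    cong (λ z → inj₂ (x , z)) (T-irrelevant _ o)

  vertexAt-cong : ∀ t {q q'} → q ≡ q' → ∀ h h' → vertexAt t q h ≡ vertexAt t q' h'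
  vertexAt-cong t refl h h' = cong (vertexAt t _) (T-irrelevant h h')

  vertexPos-isPos : ∀ t v → T (isPos t (vertexPos t v))
  vertexPos-isPos t (inj₁ (q , a)) with isFun-elim t q a
  ... | f , us , e rewrite e = tt
  vertexPos-isPos t (inj₂ (x , o)) rewrite subtermAt-varPos t x o = tt

  vertexAt-vertexPos : ∀ t v h → vertexAt t (vertexPos t v) h ≡ v
  vertexAt-vertexPos t (inj₁ (q , a)) h with isFun-elim t q a
  ... | f , us , e = vertexAt-fun t q e h a
  vertexAt-vertexPos t (inj₂ (x , o)) h = vertexAt-var t (varPos t x) (subtermAt-varPos t x o) h o

  vertexPos-vertexAt : ∀ t → Linear t → ∀ q h → vertexPos t (vertexAt t q h) ≡ q
  vertexPos-vertexAt t lin q h = go (subtermAt t q) refl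
    where
      go : (mt : Maybe Term) → subtermAt t q ≡ mt → vertexPos t (vertexAt t q h) ≡ q
      go (just (fun f us)) e rewrite vertexAt-fun t q e h (isFun-intro t q e) = refl
      go (just (var x)) e rewrite vertexAt-var t q e h (occ-at t q x e) = sym (linear-varPos t lin x q e)
      go nothing e = ⊥-elim (subst (T ∘ is-just) e h)

  labelOf : Maybe Term → Lab
  labelOf (just (fun f _)) = sy f
  labelOf _ = bot

  lV-vertexAt : ∀ t q h → lV (t °) (vertexAt t q h) ≡ labelOf (subtermAt t q)
  lV-vertexAt t q h = go (subtermAt t q) refl
    where
      go : (mt : Maybe Term) → subtermAt t q ≡ mt → lV (t °) (vertexAt t q h) ≡ labelOf mt
      go (just (fun f us)) e rewrite vertexAt-fun t q e h (isFun-intro t q e) = cong sy (symOf-eq (subtermAt t q) e (isFun-intro t q e))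
      go (just (var x)) e rewrite vertexAt-var t q e h (occ-at t q x e) = refl
      go nothing e = ⊥-elim (subst (T ∘ is-just) e h)

  edge-cong : ∀ t {q q' j j'} → q ≡ q' → j ≡ j' → ∀ a b a' b' →
              _≡_ {A = TE t} (q , j , a , b) (q' , j' , a' , b')
  edge-cong t refl refl a b a' b' rewrite T-irrelevant a a' | T-irrelevant b b' = refl

  sy≤labelOf : ∀ {f} (mt : Maybe Term) → sy f ≤L labelOf mt → Σ (Vec Term (arity f)) λ vs → mt ≡ just (fun f vs)
  sy≤labelOf (just (fun g vs)) refl≤ = vs , refl
  sy≤labelOf (just (var x)) ()
  sy≤labelOf nothing ()

  shape : Maybe Term → Maybe (Sym ⊎ Var)
  shape nothing          = nothing
  shape (just (var x))   = just (inj₂ x)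
  shape (just (fun f _)) = just (inj₁ f)

  labelOfShape : Maybe (Sym ⊎ Var) → Lab
  labelOfShape (just (inj₁ f)) = sy f
  labelOfShape _ = bot

  labelOf-shape : ∀ mt → labelOf mt ≡ labelOfShape (shape mt)
  labelOf-shape nothing = refl
  labelOf-shape (just (var x)) = refl
  labelOf-shape (just (fun f x)) = refl

  is-just-shape : ∀ mt → is-just (shape mt) ≡ is-just mt
  is-just-shape nothing = refl
  is-just-shape (just (var x)) = refl
  is-just-shape (just (fun f x)) = refl

  shape-isPos : ∀ t1 t2 Q1 Q2 → shape (subtermAt t1 Q1) ≡ shape (subtermAt t2 Q2) → T (isPos t2 Q2) → T (isPos t1 Q1)
  shape-isPos t1 t2 Q1 Q2 e h =
    subst T (trans (sym (is-just-shape (subtermAt t2 Q2))) (trans (cong is-just (sym e)) (is-just-shape (subtermAt t1 Q1)))) h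

  shape-labelOf : ∀ t1 t2 Q1 Q2 → shape (subtermAt t1 Q1) ≡ shape (subtermAt t2 Q2) → labelOf (subtermAt t2 Q2) ≡ labelOf (subtermAt t1 Q1)
  shape-labelOf t1 t2 Q1 Q2 e = trans (labelOf-shape _) (trans (cong labelOfShape (sym e)) (sym (labelOf-shape _)))

  shape-var : ∀ (mt : Maybe Term) {y} → shape mt ≡ just (inj₂ y) → mt ≡ just (var y)
  shape-var (just (var x)) refl = refl
  shape-var (just (fun f x)) ()
  shape-var nothing ()

  isPos-prefix : ∀ t q r → T (isPos t (q ++ r)) → T (isPos t q)
  isPos-prefix t q r h with subtermAt t q in e
  ... | just _ = tt
  ... | nothing rewrite subtermAt-++-nothing t q r e = h

module Substitution (S : Signature) where
  open Signature S
  open TRS S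
  open Positions S

  mutual
    walkToVar : Term → Pos → Maybe (Var × Pos)
    walkToVar (var x) q = just (x , q)
    walkToVar (fun f ts) [] = nothing
    walkToVar (fun f ts) (j ∷ q) = walkToVarArgs ts j q

    walkToVarArgs : ∀ {n} → Vec Term n → ℕ → Pos → Maybe (Var × Pos)
    walkToVarArgs [] j q = nothing
    walkToVarArgs (t ∷ ts) zero q = walkToVar t q
    walkToVarArgs (t ∷ ts) (suc j) q = walkToVarArgs ts j q

  mutual
    subtermAt-⟨⟩-above : ∀ u q σ → walkToVar u q ≡ nothing → subtermAt (u ⟨ σ ⟩) q ≡ mapM (_⟨ σ ⟩) (subtermAt u q)
    subtermAt-⟨⟩-above (var x) q σ ()
    subtermAt-⟨⟩-above (fun f ts) [] σ e = refl
    subtermAt-⟨⟩-above (fun f ts) (j ∷ q) σ e = argAt-⟨⟩-above ts j q σ e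

    argAt-⟨⟩-above : ∀ {n} (ts : Vec Term n) j q σ → walkToVarArgs ts j q ≡ nothing →
                     argAt (substArgs ts σ) j q ≡ mapM (_⟨ σ ⟩) (argAt ts j q)
    argAt-⟨⟩-above [] j q σ e = refl
    argAt-⟨⟩-above (t ∷ ts) zero q σ e = subtermAt-⟨⟩-above t q σ e
    argAt-⟨⟩-above (t ∷ ts) (suc j) q σ e = argAt-⟨⟩-above ts j q σ e

  mutual
    subtermAt-⟨⟩-below : ∀ u q σ {x rest} → walkToVar u q ≡ just (x , rest) → subtermAt (u ⟨ σ ⟩) q ≡ subtermAt (σ x) rest
    subtermAt-⟨⟩-below (var y) q σ refl = refl
    subtermAt-⟨⟩-below (fun f ts) [] σ ()
    subtermAt-⟨⟩-below (fun f ts) (j ∷ q) σ e = argAt-⟨⟩-below ts j q σ e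

    argAt-⟨⟩-below : ∀ {n} (ts : Vec Term n) j q σ {x rest} → walkToVarArgs ts j q ≡ just (x , rest) →
                     argAt (substArgs ts σ) j q ≡ subtermAt (σ x) rest
    argAt-⟨⟩-below [] j q σ ()
    argAt-⟨⟩-below (t ∷ ts) zero q σ e = subtermAt-⟨⟩-below t q σ e
    argAt-⟨⟩-below (t ∷ ts) (suc j) q σ e = argAt-⟨⟩-below ts j q σ e

  mutual
    walkToVar-split : ∀ u q {x rest} → walkToVar u q ≡ just (x , rest) → Σ Pos λ qx → (q ≡ qx ++ rest) × (subtermAt u qx ≡ just (var x))
    walkToVar-split (var y) q refl = [] , refl , refl
    walkToVar-split (fun f ts) [] ()
    walkToVar-split (fun f ts) (j ∷ q) e with walkToVarArgs-split ts j q e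
    ... | qx , e1 , e2 = j ∷ qx , cong (j ∷_) e1 , e2

    walkToVarArgs-split : ∀ {n} (ts : Vec Term n) j q {x rest} → walkToVarArgs ts j q ≡ just (x , rest) →
                          Σ Pos λ qx → (q ≡ qx ++ rest) × (argAt ts j qx ≡ just (var x))
    walkToVarArgs-split [] j q ()
    walkToVarArgs-split (t ∷ ts) zero q e = walkToVar-split t q e
    walkToVarArgs-split (t ∷ ts) (suc j) q e = walkToVarArgs-split ts j q e

  mutual
    walkToVar-through : ∀ u qx {x} rest → subtermAt u qx ≡ just (var x) → walkToVar u (qx ++ rest) ≡ just (x , rest)
    walkToVar-through (var y) [] rest refl = refl
    walkToVar-through (var y) (j ∷ qx) rest ()
    walkToVar-through (fun f ts) [] rest ()
    walkToVar-through (fun f ts) (j ∷ qx) rest e = walkToVarArgs-through ts j qx rest e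

    walkToVarArgs-through : ∀ {n} (ts : Vec Term n) j qx {x} rest → argAt ts j qx ≡ just (var x) → walkToVarArgs ts j (qx ++ rest) ≡ just (x , rest)
    walkToVarArgs-through [] j qx rest ()
    walkToVarArgs-through (t ∷ ts) zero qx rest e = walkToVar-through t qx rest e
    walkToVarArgs-through (t ∷ ts) (suc j) qx rest e = walkToVarArgs-through ts j qx rest e

  mutual
    walkToVar-fun : ∀ u q {f us} → subtermAt u q ≡ just (fun f us) → walkToVar u q ≡ nothing
    walkToVar-fun (var y) [] ()
    walkToVar-fun (var y) (j ∷ q) ()
    walkToVar-fun (fun f ts) [] e = refl
    walkToVar-fun (fun f ts) (j ∷ q) e = walkToVarArgs-fun ts j q e

    walkToVarArgs-fun : ∀ {n} (ts : Vec Term n) j q {f us} → argAt ts j q ≡ just (fun f us) → walkToVarArgs ts j q ≡ nothing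
    walkToVarArgs-fun [] j q ()
    walkToVarArgs-fun (t ∷ ts) zero q e = walkToVar-fun t q e
    walkToVarArgs-fun (t ∷ ts) (suc j) q e = walkToVarArgs-fun ts j q e

  walkToVar-nothing⇒fun : ∀ u q σ → walkToVar u q ≡ nothing → T (isPos (u ⟨ σ ⟩) q) →
       Σ Sym λ f → Σ (Vec Term (arity f)) λ us → subtermAt u q ≡ just (fun f us)
  walkToVar-nothing⇒fun u q σ e h with subtermAt u q in e2
  ... | just (fun f us) = f , us , refl
  ... | just (var x) with trans (sym (walkToVar-through u q [] e2)) (trans (cong (walkToVar u) (++-identityʳ q)) e)
  ... | ()
  walkToVar-nothing⇒fun u q σ e h | nothing rewrite subtermAt-⟨⟩-above u q σ e | e2 = ⊥-elim h

  subtermAt-⟨⟩-fun : ∀ u q σ {f us} → subtermAt u q ≡ just (fun f us) → subtermAt (u ⟨ σ ⟩) q ≡ just (fun f (substArgs us σ))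
  subtermAt-⟨⟩-fun u q σ e = trans (subtermAt-⟨⟩-above u q σ (walkToVar-fun u q e)) (cong (mapM (_⟨ σ ⟩)) e)

  isPos-⟨⟩ : ∀ u q σ → T (isPos u q) → T (isPos (u ⟨ σ ⟩) q)
  isPos-⟨⟩ u q σ h with subtermAt u q in e
  ... | just (fun f us) rewrite subtermAt-⟨⟩-fun u q σ e = tt
  ... | just (var x) rewrite subtermAt-⟨⟩-below u q σ (subst (λ z → walkToVar u z ≡ just (x , [])) (++-identityʳ q) (walkToVar-through u q [] e)) = tt

  labelOf-⟨⟩ : ∀ u q σ → labelOf (subtermAt u q) ≤L labelOf (subtermAt (u ⟨ σ ⟩) q)
  labelOf-⟨⟩ u q σ with subtermAt u q in e
  ... | just (fun f us) rewrite subtermAt-⟨⟩-fun u q σ e = refl≤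
  ... | just (var x) = bot≤
  ... | nothing = bot≤

module Replacement (S : Signature) where
  open Signature S
  open TRS S
  open Positions S
  open Substitution S

  mutual
    replaceAt : Term → Pos → Term → Term
    replaceAt t [] u = u
    replaceAt (var x) (j ∷ q) u = var x
    replaceAt (fun f ts) (j ∷ q) u = fun f (replaceArgs ts j q u)

    replaceArgs : ∀ {n} → Vec Term n → ℕ → Pos → Term → Vec Term n
    replaceArgs [] j q u = []
    replaceArgs (t ∷ ts) zero q u = replaceAt t q u ∷ ts
    replaceArgs (t ∷ ts) (suc j) q u = t ∷ replaceArgs ts j q u

  mutual
    subtermAt-replaceAt : ∀ t p q u → T (isPos t p) → subtermAt (replaceAt t p u) (p ++ q) ≡ subtermAt u q
    subtermAt-replaceAt t [] q u h = refl
    subtermAt-replaceAt (var x) (j ∷ p) q u ()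
    subtermAt-replaceAt (fun f ts) (j ∷ p) q u h = argAt-replaceArgs ts j p q u h

    argAt-replaceArgs : ∀ {n} (ts : Vec Term n) j p q u → T (is-just (argAt ts j p)) → argAt (replaceArgs ts j p u) j (p ++ q) ≡ subtermAt u q
    argAt-replaceArgs [] j p q u ()
    argAt-replaceArgs (t ∷ ts) zero p q u h = subtermAt-replaceAt t p q u h
    argAt-replaceArgs (t ∷ ts) (suc j) p q u h = argAt-replaceArgs ts j p q u h

  mutual
    replaceAt-self : ∀ t p {w} → subtermAt t p ≡ just w → replaceAt t p w ≡ t
    replaceAt-self t [] refl = refl
    replaceAt-self (var x) (j ∷ p) e = refl
    replaceAt-self (fun f ts) (j ∷ p) e = cong (fun f) (replaceArgs-self ts j p e)

    replaceArgs-self : ∀ {n} (ts : Vec Term n) j p {w} → argAt ts j p ≡ just w → replaceArgs ts j p w ≡ ts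
    replaceArgs-self [] j p e = refl
    replaceArgs-self (t ∷ ts) zero p e = cong (_∷ ts) (replaceAt-self t p e)
    replaceArgs-self (t ∷ ts) (suc j) p e = cong (t ∷_) (replaceArgs-self ts j p e)

  argAt-replaceArgs-other : ∀ {n} (ts : Vec Term n) i j p q u → i ≢ j → argAt (replaceArgs ts i p u) j q ≡ argAt ts j q
  argAt-replaceArgs-other [] i j p q u i≢j = refl
  argAt-replaceArgs-other (t ∷ ts) zero zero p q u i≢j = ⊥-elim (i≢j refl)
  argAt-replaceArgs-other (t ∷ ts) zero (suc j) p q u e = refl
  argAt-replaceArgs-other (t ∷ ts) (suc i) zero p q u e = refl
  argAt-replaceArgs-other (t ∷ ts) (suc i) (suc j) p q u i≢j = argAt-replaceArgs-other ts i j p q u (i≢j ∘ cong suc)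

  mutual
    shape-replaceAt-outside : ∀ t p q u → T (isPos t p) → stripPrefix p q ≡ nothing → shape (subtermAt (replaceAt t p u) q) ≡ shape (subtermAt t q)
    shape-replaceAt-outside t [] q u h ()
    shape-replaceAt-outside (var x) (i ∷ p) q u () e
    shape-replaceAt-outside (fun f ts) (i ∷ p) [] u h e = refl
    shape-replaceAt-outside (fun f ts) (i ∷ p) (j ∷ q) u h e with i ≟ j
    ... | yes refl = shape-replaceArgs-outside ts j p q u h e
    ... | no i≢j rewrite argAt-replaceArgs-other ts i j p q u i≢j = refl

    shape-replaceArgs-outside : ∀ {n} (ts : Vec Term n) j p q u → T (is-just (argAt ts j p)) → stripPrefix p q ≡ nothing →
          shape (argAt (replaceArgs ts j p u) j q) ≡ shape (argAt ts j q)
    shape-replaceArgs-outside [] j p q u () e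
    shape-replaceArgs-outside (t ∷ ts) zero p q u h e = shape-replaceAt-outside t p q u h e
    shape-replaceArgs-outside (t ∷ ts) (suc j) p q u h e = shape-replaceArgs-outside ts j p q u h e

  mutual
    contextAt : Term → Pos → Ctx
    contextAt (var x) q = □
    contextAt (fun f ts) [] = □
    contextAt (fun f ts) (j ∷ q) = contextAtArg f ts j q (j <? arity f)

    contextAtArg : (f : Sym) (ts : Vec Term (arity f)) (j : ℕ) (q : Pos) → Dec (j < arity f) → Ctx
    contextAtArg f ts j q (yes j<) = arg f (fromℕ< j<) ts (contextAt (lookup ts (fromℕ< j<)) q)
    contextAtArg f ts j q (no _) = □

  argAt-lookup : ∀ {n} (ts : Vec Term n) j (j< : j < n) q → argAt ts j q ≡ subtermAt (lookup ts (fromℕ< j<)) q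
  argAt-lookup (t ∷ ts) zero (s≤s j<) q = refl
  argAt-lookup (t ∷ ts) (suc j) (s≤s j<) q = argAt-lookup ts j j< q

  replaceArgs-≔ : ∀ {n} (ts : Vec Term n) j (j< : j < n) q u → replaceArgs ts j q u ≡ ts [ fromℕ< j< ]≔ replaceAt (lookup ts (fromℕ< j<)) q u
  replaceArgs-≔ (t ∷ ts) zero (s≤s j<) q u = refl
  replaceArgs-≔ (t ∷ ts) (suc j) (s≤s j<) q u = cong (t ∷_) (replaceArgs-≔ ts j j< q u)

  argAt-< : ∀ {n} (ts : Vec Term n) j q → T (is-just (argAt ts j q)) → j < n
  argAt-< [] j q ()
  argAt-< (t ∷ ts) zero q h = s≤s z≤n
  argAt-< (t ∷ ts) (suc j) q h = s≤s (argAt-< ts j q h)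

  replaceAt≡plug : ∀ t p u → T (isPos t p) → replaceAt t p u ≡ plug (contextAt t p) u
  replaceAt≡plug t [] u h with t
  ... | var x = refl
  ... | fun f ts = refl
  replaceAt≡plug (var x) (j ∷ p) u ()
  replaceAt≡plug (fun f ts) (j ∷ p) u h with j <? arity f
  ... | no ¬j< = ⊥-elim (¬j< (argAt-< ts j p h))
  ... | yes j< rewrite replaceArgs-≔ ts j j< p u =
    cong (λ z → fun f (ts [ fromℕ< j< ]≔ z))
         (replaceAt≡plug (lookup ts (fromℕ< j<)) p u (subst (T ∘ is-just) (argAt-lookup ts j j< p) h))

  -- A position Q of s or t is classified against the redex at p with pattern u
  -- as classify u (stripPrefix p Q).
  data PosClass : Set where
    inContext : PosClass
    inPattern : Pos → PosClass
    belowVar : Var → Pos → PosClass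

  classifyInside : Pos → Maybe (Var × Pos) → PosClass
  classifyInside q nothing = inPattern q
  classifyInside q (just (x , rest)) = belowVar x rest

  classify : Term → Maybe Pos → PosClass
  classify u nothing = inContext
  classify u (just q) = classifyInside q (walkToVar u q)

  classify-inContext : ∀ u mq → classify u mq ≡ inContext → mq ≡ nothing
  classify-inContext u nothing e = refl
  classify-inContext u (just q) e with walkToVar u q
  classify-inContext u (just q) () | nothing
  classify-inContext u (just q) () | just _

  classify-inPattern : ∀ u mq {q'} → classify u mq ≡ inPattern q' → (mq ≡ just q') × (walkToVar u q' ≡ nothing)
  classify-inPattern u nothing ()
  classify-inPattern u (just q) e with walkToVar u q in ew
  classify-inPattern u (just q) refl | nothing = refl , ew
  classify-inPattern u (just q) () | just _

  classify-belowVar : ∀ u mq {x rest} → classify u mq ≡ belowVar x rest → Σ Pos λ q' → (mq ≡ just q') × (walkToVar u q' ≡ just (x , rest))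
  classify-belowVar u nothing ()
  classify-belowVar u (just q) e with walkToVar u q in ew
  classify-belowVar u (just q) () | nothing
  classify-belowVar u (just q) refl | just _ = q , refl , ew

module Graphs (S : Signature) where
  open TRS S

  ≤L-subst : ∀ {a a' b b'} → a ≡ a' → b ≡ b' → a ≤L b → a' ≤L b'
  ≤L-subst refl refl a≤b = a≤b

  ≤bot⇒≤ : ∀ {a} c → a ≤L bot → a ≤L c
  ≤bot⇒≤ c bot≤  = bot≤
  ≤bot⇒≤ c refl≤ = bot≤

  num-≤L-injective : ∀ {i j} → num i ≤L num j → i ≡ j
  num-≤L-injective refl≤ = refl

  old-injective : ∀ {G : RGraph} {a b} → CV.old {G} a ≡ old b → a ≡ b
  old-injective refl = refl

  -- Morphisms out of these probe graphs pick a single vertex / edge, so the universal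
  -- property of a pullback can be applied to individual elements.
  pointGraph : Lab → Graph
  pointGraph lab = record { V = ⊤ ; E = Empty ; src = λ () ; tgt = λ () ; lV = λ _ → lab ; lE = λ () }

  pointAt : (H : Graph) (lab : Lab) (v : V H) → lab ≤L lV H v → Hom (pointGraph lab) H
  pointAt H lab v le = record { hV = λ _ → v ; hE = λ () ; h-src = λ () ; h-tgt = λ ()
                              ; h-lV = λ _ → le ; h-lE = λ () }

  edgeGraph : Lab → Graph
  edgeGraph lab = record { V = Bool ; E = ⊤ ; src = λ _ → false ; tgt = λ _ → true ; lV = λ _ → bot ; lE = λ _ → lab }

  edgeEnd : (H : Graph) (e : E H) → Bool → V H
  edgeEnd H e false = src H e
  edgeEnd H e true  = tgt H e

  edgeAt : (H : Graph) (lab : Lab) (e : E H) → lab ≤L lE H e → Hom (edgeGraph lab) H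
  edgeAt H lab e le = record { hV = edgeEnd H e ; hE = λ _ → e ; h-src = λ _ → refl ; h-tgt = λ _ → refl
                             ; h-lV = λ _ → bot≤ ; h-lE = λ _ → le }

  module PullbackElements {A B C P : Graph} {f : Hom A C} {g : Hom B C} {p₁ : Hom P A} {p₂ : Hom P B}
                          (pb : IsPullback f g p₁ p₂) where

    vertexPairU : ∀ lab (a : V A) (b : V B) → hV f a ≡ hV g b → (l₁ : lab ≤L lV A a) (l₂ : lab ≤L lV B b) →
                  Σ (Hom (pointGraph lab) P) λ z → ((p₁ ∘H z) ≈H pointAt A lab a l₁) × ((p₂ ∘H z) ≈H pointAt B lab b l₂) ×
                    (∀ w → (p₁ ∘H w) ≈H pointAt A lab a l₁ → (p₂ ∘H w) ≈H pointAt B lab b l₂ → w ≈H z)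
    vertexPairU lab a b e l₁ l₂ =
      IsPullback.universal pb (pointGraph lab) (pointAt A lab a l₁) (pointAt B lab b l₂) ((λ _ → e) , (λ ()))

    vertexPair : (a : V A) (b : V B) → hV f a ≡ hV g b → V P
    vertexPair a b e = hV (proj₁ (vertexPairU bot a b e bot≤ bot≤)) tt

    vertexPair-p₁ : ∀ a b e → hV p₁ (vertexPair a b e) ≡ a
    vertexPair-p₁ a b e = proj₁ (proj₁ (proj₂ (vertexPairU bot a b e bot≤ bot≤))) tt

    vertexPair-p₂ : ∀ a b e → hV p₂ (vertexPair a b e) ≡ b
    vertexPair-p₂ a b e = proj₁ (proj₁ (proj₂ (proj₂ (vertexPairU bot a b e bot≤ bot≤)))) tt

    vertexPair-unique : ∀ a b e w → hV p₁ w ≡ a → hV p₂ w ≡ b → w ≡ vertexPair a b e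
    vertexPair-unique a b e w e₁ e₂ =
      proj₁ (proj₂ (proj₂ (proj₂ (vertexPairU bot a b e bot≤ bot≤))) (pointAt P bot w bot≤)
              ((λ _ → e₁) , (λ ())) ((λ _ → e₂) , (λ ()))) tt

    vertexPair-cong : ∀ {a a' b b'} e e' → a ≡ a' → b ≡ b' → vertexPair a b e ≡ vertexPair a' b' e'
    vertexPair-cong {a} {a'} {b} {b'} e e' ea eb =
      vertexPair-unique a' b' e' _ (trans (vertexPair-p₁ a b e) ea) (trans (vertexPair-p₂ a b e) eb)

    vertexPair-lab : ∀ lab a b e → lab ≤L lV A a → lab ≤L lV B b → lab ≤L lV P (vertexPair a b e)
    vertexPair-lab lab a b e l₁ l₂ = subst (λ z → lab ≤L lV P z) same (h-lV (proj₁ U) tt)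
      where
        U = vertexPairU lab a b e l₁ l₂
        same : hV (proj₁ U) tt ≡ vertexPair a b e
        same = vertexPair-unique a b e _ (proj₁ (proj₁ (proj₂ U)) tt) (proj₁ (proj₁ (proj₂ (proj₂ U))) tt)

    src-compatible : ∀ a b → hE f a ≡ hE g b → hV f (src A a) ≡ hV g (src B b)
    src-compatible a b e = trans (h-src f a) (trans (cong (src C) e) (sym (h-src g b)))

    tgt-compatible : ∀ a b → hE f a ≡ hE g b → hV f (tgt A a) ≡ hV g (tgt B b)
    tgt-compatible a b e = trans (h-tgt f a) (trans (cong (tgt C) e) (sym (h-tgt g b)))

    edgePairU : ∀ lab (a : E A) (b : E B) → hE f a ≡ hE g b → (l₁ : lab ≤L lE A a) (l₂ : lab ≤L lE B b) →
                Σ (Hom (edgeGraph lab) P) λ z → ((p₁ ∘H z) ≈H edgeAt A lab a l₁) × ((p₂ ∘H z) ≈H edgeAt B lab b l₂) ×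
                  (∀ w → (p₁ ∘H w) ≈H edgeAt A lab a l₁ → (p₂ ∘H w) ≈H edgeAt B lab b l₂ → w ≈H z)
    edgePairU lab a b e l₁ l₂ =
      IsPullback.universal pb (edgeGraph lab) (edgeAt A lab a l₁) (edgeAt B lab b l₂) (ends , (λ _ → e))
      where
        ends : ∀ end → hV f (edgeEnd A a end) ≡ hV g (edgeEnd B b end)
        ends false = src-compatible a b e
        ends true  = tgt-compatible a b e

    edgePair : (a : E A) (b : E B) → hE f a ≡ hE g b → E P
    edgePair a b e = hE (proj₁ (edgePairU bot a b e bot≤ bot≤)) tt

    edgePair-p₁ : ∀ a b e → hE p₁ (edgePair a b e) ≡ a
    edgePair-p₁ a b e = proj₂ (proj₁ (proj₂ (edgePairU bot a b e bot≤ bot≤))) tt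

    edgePair-p₂ : ∀ a b e → hE p₂ (edgePair a b e) ≡ b
    edgePair-p₂ a b e = proj₂ (proj₁ (proj₂ (proj₂ (edgePairU bot a b e bot≤ bot≤)))) tt

    edgePair-unique : ∀ a b e w → hE p₁ w ≡ a → hE p₂ w ≡ b → w ≡ edgePair a b e
    edgePair-unique a b e w e₁ e₂ =
      proj₂ (proj₂ (proj₂ (proj₂ (edgePairU bot a b e bot≤ bot≤))) (edgeAt P bot w bot≤) (ends₁ , (λ _ → e₁)) (ends₂ , (λ _ → e₂))) tt
      where
        ends₁ : ∀ end → hV p₁ (edgeEnd P w end) ≡ edgeEnd A a end
        ends₁ false = trans (h-src p₁ w) (cong (src A) e₁)
        ends₁ true  = trans (h-tgt p₁ w) (cong (tgt A) e₁)
        ends₂ : ∀ end → hV p₂ (edgeEnd P w end) ≡ edgeEnd B b end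
        ends₂ false = trans (h-src p₂ w) (cong (src B) e₂)
        ends₂ true  = trans (h-tgt p₂ w) (cong (tgt B) e₂)

    edgePair-lab : ∀ lab a b e → lab ≤L lE A a → lab ≤L lE B b → lab ≤L lE P (edgePair a b e)
    edgePair-lab lab a b e l₁ l₂ = subst (λ z → lab ≤L lE P z) same (h-lE (proj₁ U) tt)
      where
        U = edgePairU lab a b e l₁ l₂
        same : hE (proj₁ U) tt ≡ edgePair a b e
        same = edgePair-unique a b e _ (proj₂ (proj₁ (proj₂ U)) tt) (proj₂ (proj₁ (proj₂ (proj₂ U))) tt)

    edgePair-src : ∀ a b e → src P (edgePair a b e) ≡ vertexPair (src A a) (src B b) (src-compatible a b e)
    edgePair-src a b e = vertexPair-unique _ _ _ _ (trans (h-src p₁ _) (cong (src A) (edgePair-p₁ a b e)))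
                                                   (trans (h-src p₂ _) (cong (src B) (edgePair-p₂ a b e)))

    edgePair-tgt : ∀ a b e → tgt P (edgePair a b e) ≡ vertexPair (tgt A a) (tgt B b) (tgt-compatible a b e)
    edgePair-tgt a b e = vertexPair-unique _ _ _ _ (trans (h-tgt p₁ _) (cong (tgt A) (edgePair-p₁ a b e)))
                                                   (trans (h-tgt p₂ _) (cong (tgt B) (edgePair-p₂ a b e)))

  pushout-≅ : ∀ {A B C Q X} {f : Hom C A} {g : Hom C B} {i₁ : Hom A Q} {i₂ : Hom B Q} → IsPushout f g i₁ i₂ →
              (to : Hom Q X) (from : Hom X Q) → (to ∘H from) ≈H idH →
              ((from ∘H to) ∘H i₁) ≈H i₁ → ((from ∘H to) ∘H i₂) ≈H i₂ → Q ≅ X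
  pushout-≅ {i₁ = i₁} {i₂} po to from to∘from fix₁ fix₂ = record
    { to = to ; from = from ; to∘from = to∘from
    ; from∘to = (λ v → trans (proj₁ e₁ v) (sym (proj₁ e₂ v))) , (λ e → trans (proj₂ e₁ e) (sym (proj₂ e₂ e))) }
    where
      unique = proj₂ (proj₂ (proj₂ (IsPushout.universal po _ i₁ i₂ (IsPushout.commutes po))))
      e₁ = unique (from ∘H to) fix₁ fix₂
      e₂ = unique idH ((λ _ → refl) , (λ _ → refl)) ((λ _ → refl) , (λ _ → refl))

  module _ (G : RGraph) where

    closure-out-prm : ∀ (e : CE G) {w o} → src (closure G) e ≡ prm w o → e ≡ prmLp w o
    closure-out-prm (oldE _)    ()
    closure-out-prm (toPrm _ _) ()
    closure-out-prm (prmLp _ _) refl = refl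
    closure-out-prm toRoot      ()
    closure-out-prm ctxLp       ()

    closure-out-ctx : ∀ (e : CE G) → src (closure G) e ≡ ctxV → (e ≡ ctxLp) ⊎ (e ≡ toRoot)
    closure-out-ctx (oldE _)    ()
    closure-out-ctx (toPrm _ _) ()
    closure-out-ctx (prmLp _ _) ()
    closure-out-ctx toRoot      refl = inj₂ refl
    closure-out-ctx ctxLp       refl = inj₁ refl

  closure-out-var : ∀ u (e : CE (enc u)) {x o} → src (closure (enc u)) e ≡ old (inj₂ (x , o)) → e ≡ toPrm (inj₂ (x , o)) tt
  closure-out-var u (oldE _)    ()
  closure-out-var u (toPrm _ _) refl = refl
  closure-out-var u (prmLp _ _) ()
  closure-out-var u toRoot      ()
  closure-out-var u ctxLp       ()

module Lemma34 (S : Signature) where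
  open Signature S
  open TRS S
  open Positions S
  open Substitution S
  open Replacement S
  open Graphs S

  module Analysis (ρ : Rule) (linL : Linear (Rule.lhs ρ)) (linR : Linear (Rule.rhs ρ))
                  (s : Term) (linS : Linear s) (G : Graph) (st : Step (ρ °R) (s °) G) where
    open Step st

    lt rt : Term
    lt = Rule.lhs ρ
    rt = Rule.rhs ρ

    Lo So Ro L' K K' : Graph
    Lo = lt °
    So = s °
    Ro = rt °
    L' = closure (enc lt)
    K = gr (disc rt)
    K' = closure (disc rt)

    l′ : Hom K' L'
    l′ = PRule.l' (ρ °R)

    sVertex : ∀ Q → T (isPos s Q) → V So
    sVertex = vertexAt s

    rootL : V Lo
    rootL = root (enc lt)

    α-old⇒matched : ∀ v a → hV α v ≡ old a → v ≡ hV m a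
    α-old⇒matched v a e = trans (sym (Match.vertexPair-p₂ a v (sym e))) (cong (hV m) (Match.vertexPair-p₁ a v (sym e)))
      where module Match = PullbackElements pb₁

    p : Pos
    p = vertexPos s (hV m rootL)

    -- m preserves edge labels, so it sends the i-th child of a vertex of l° to the
    -- i-th child of its image in s°.
    matchPos-snoc : ∀ q j → (∀ h → vertexPos s (hV m (vertexAt lt q h)) ≡ p ++ q) →
              ∀ h → vertexPos s (hV m (vertexAt lt (q ++ [ j ]) h)) ≡ p ++ (q ++ [ j ])
    matchPos-snoc q j ih h with parent-is-fun lt q j h
    ... | f , us , e = go (hE m (q , j , isFun-intro lt q e , h)) (h-src m (q , j , isFun-intro lt q e , h))
                          (h-tgt m (q , j , isFun-intro lt q e , h)) (h-lE m (q , j , isFun-intro lt q e , h))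
      where
        go : (e' : TE s) → hV m (inj₁ (q , isFun-intro lt q e)) ≡ src So e' →
             hV m (vertexAt lt (q ++ [ j ]) h) ≡ tgt So e' → num j ≤L lE So e' →
             vertexPos s (hV m (vertexAt lt (q ++ [ j ]) h)) ≡ p ++ (q ++ [ j ])
        go (p' , j' , a' , b') es et el with num-≤L-injective el
        ... | refl = trans (cong (vertexPos s) et)
                       (trans (vertexPos-vertexAt s linS (p' ++ [ j ]) b')
                       (trans (cong (_++ [ j ]) p'≡) (++-assoc p q [ j ])))
          where
            p'≡ : p' ≡ p ++ q
            p'≡ = trans (sym (cong (vertexPos s) es))
                    (trans (cong (λ z → vertexPos s (hV m z)) (sym (vertexAt-fun lt q e (isPos-intro lt q e) (isFun-intro lt q e))))
                      (ih (isPos-intro lt q e)))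

    matchPos : ∀ q h → vertexPos s (hV m (vertexAt lt q h)) ≡ p ++ q
    matchPos = snoc-induction (λ q → ∀ h → vertexPos s (hV m (vertexAt lt q h)) ≡ p ++ q)
                 (λ h → trans (cong (λ z → vertexPos s (hV m z)) (vertexAt-cong lt refl h tt)) (sym (++-identityʳ p)))
                 matchPos-snoc

    isPos-match : ∀ q h → T (isPos s (p ++ q))
    isPos-match q h = subst (T ∘ isPos s) (matchPos q h) (vertexPos-isPos s (hV m (vertexAt lt q h)))

    match-vertexAt : ∀ q h h' → hV m (vertexAt lt q h) ≡ sVertex (p ++ q) h'
    match-vertexAt q h hh = trans (sym (vertexAt-vertexPos s (hV m (vertexAt lt q h)) (vertexPos-isPos s (hV m (vertexAt lt q h)))))
                                  (vertexAt-cong s (matchPos q h) _ hh)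

    match-fun : ∀ q {f us} → subtermAt lt q ≡ just (fun f us) → Σ (Vec Term (arity f)) λ vs' → subtermAt s (p ++ q) ≡ just (fun f vs')
    match-fun q {f} e = sy≤labelOf (subtermAt s (p ++ q)) le
      where
        h = isPos-intro lt q e
        le : sy f ≤L labelOf (subtermAt s (p ++ q))
        le = ≤L-subst (trans (lV-vertexAt lt q h) (cong labelOf e))
                      (trans (cong (lV So) (match-vertexAt q h (isPos-match q h))) (lV-vertexAt s (p ++ q) (isPos-match q h)))
                      (h-lV m (vertexAt lt q h))

    -- Variables not occurring in l get a junk value; σ is only used on Var(l).
    σ : Subst
    σ x = fromMaybe (var x) (subtermAt s (p ++ varPos lt x))

    mutual
      match-subterm : ∀ u q → subtermAt lt q ≡ just u → subtermAt s (p ++ q) ≡ just (u ⟨ σ ⟩)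
      match-subterm (var x) q e with linear-varPos lt linL x q e
      ... | refl with isPos-elim s (p ++ q) (isPos-match q (isPos-intro lt q e))
      ... | w , e2 rewrite e2 = refl
      match-subterm (fun f us) q e with match-fun q e
      ... | vs' , e2 rewrite e2 = cong (just ∘ fun f) (match-args us vs' (λ j → q ++ [ j ]) hl hs)
        where
          hl : ∀ j → argAt us j [] ≡ subtermAt lt (q ++ [ j ])
          hl j = sym (subtermAt-++ lt q [ j ] e)
          hs : ∀ j → argAt vs' j [] ≡ subtermAt s (p ++ (q ++ [ j ]))
          hs j = sym (trans (cong (subtermAt s) (sym (++-assoc p q [ j ]))) (subtermAt-++ s (p ++ q) [ j ] e2))

      match-args : ∀ {k} (us vs' : Vec Term k) (g : ℕ → Pos) → (∀ j → argAt us j [] ≡ subtermAt lt (g j)) →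
            (∀ j → argAt vs' j [] ≡ subtermAt s (p ++ g j)) → vs' ≡ substArgs us σ
      match-args [] [] g hl hs = refl
      match-args (u0 ∷ us) (v0 ∷ vs') g hl hs =
        cong₂ _∷_ (just-injective (trans (hs 0) (match-subterm u0 (g 0) (sym (hl 0)))))
                  (match-args us vs' (g ∘ suc) (hl ∘ suc) (hs ∘ suc))

    s-at-p : subtermAt s p ≡ just (lt ⟨ σ ⟩)
    s-at-p = trans (cong (subtermAt s) (sym (++-identityʳ p))) (match-subterm lt [] refl)

    isPos-p : T (isPos s p)
    isPos-p = isPos-intro s p s-at-p

    t : Term
    t = replaceAt s p (rt ⟨ σ ⟩)

    s⟶t : s ⟶[ ρ ] t
    s⟶t = contextAt s p , σ , trans (sym (replaceAt-self s p s-at-p)) (replaceAt≡plug s p _ isPos-p) , replaceAt≡plug s p _ isPos-p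

    classS classT : Pos → PosClass
    classS Q = classify lt (stripPrefix p Q)
    classT Q = classify rt (stripPrefix p Q)

    s-below-p : ∀ q → subtermAt s (p ++ q) ≡ subtermAt (lt ⟨ σ ⟩) q
    s-below-p q = subtermAt-++ s p q s-at-p

    t-below-p : ∀ q → subtermAt t (p ++ q) ≡ subtermAt (rt ⟨ σ ⟩) q
    t-below-p q = subtermAt-replaceAt s p q (rt ⟨ σ ⟩) isPos-p

    t-outside-p : ∀ Q → stripPrefix p Q ≡ nothing → shape (subtermAt t Q) ≡ shape (subtermAt s Q)
    t-outside-p Q e = shape-replaceAt-outside s p Q (rt ⟨ σ ⟩) isPos-p e

    isPos-t-p : T (isPos t p)
    isPos-t-p = isPos-intro t p (trans (cong (subtermAt t) (sym (++-identityʳ p))) (t-below-p []))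

    s-below-var : ∀ x → T (occurs x lt) → ∀ R → subtermAt s (p ++ varPos lt x ++ R) ≡ subtermAt (σ x) R
    s-below-var x o R = trans (s-below-p _) (subtermAt-⟨⟩-below lt _ σ (walkToVar-through lt (varPos lt x) R (subtermAt-varPos lt x o)))

    t-below-var : ∀ x → T (occurs x rt) → ∀ R → subtermAt t (p ++ varPos rt x ++ R) ≡ subtermAt (σ x) R
    t-below-var x o R = trans (t-below-p _) (subtermAt-⟨⟩-below rt _ σ (walkToVar-through rt (varPos rt x) R (subtermAt-varPos rt x o)))

    t≈s-below-var : ∀ x → T (occurs x rt) → ∀ R → subtermAt t (p ++ varPos rt x ++ R) ≡ subtermAt s (p ++ varPos lt x ++ R)
    t≈s-below-var x o R = trans (t-below-var x o R) (sym (s-below-var x (Rule.vars⊆ ρ x o) R))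

    classS-var : ∀ x → T (occurs x lt) → ∀ R → classS (p ++ varPos lt x ++ R) ≡ belowVar x R
    classS-var x o R rewrite stripPrefix-++ p (varPos lt x ++ R) | walkToVar-through lt (varPos lt x) R (subtermAt-varPos lt x o) = refl

    classT-var : ∀ x → T (occurs x rt) → ∀ R → classT (p ++ varPos rt x ++ R) ≡ belowVar x R
    classT-var x o R rewrite stripPrefix-++ p (varPos rt x ++ R) | walkToVar-through rt (varPos rt x) R (subtermAt-varPos rt x o) = refl

    classS-ctx : ∀ Q → stripPrefix p Q ≡ nothing → classS Q ≡ inContext
    classS-ctx Q e rewrite e = refl

    classT-ctx : ∀ Q → stripPrefix p Q ≡ nothing → classT Q ≡ inContext
    classT-ctx Q e rewrite e = refl

    classT-inv-var : ∀ Q {x R} → classT Q ≡ belowVar x R → (Q ≡ p ++ varPos rt x ++ R) × T (occurs x rt)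
    classT-inv-var Q {x} {R} e with classify-belowVar rt (stripPrefix p Q) e
    ... | q' , e1 , e2 with walkToVar-split rt q' e2
    ... | qx , e3 , e4 with linear-varPos rt linR x qx e4
    ... | refl = trans (stripPrefix-just p Q e1) (cong (p ++_) e3) , occ-at rt qx x e4

    classT-inv-fun : ∀ Q {q'} → classT Q ≡ inPattern q' → T (isPos t Q) →
                     (Q ≡ p ++ q') × (Σ Sym λ f → Σ (Vec Term (arity f)) λ us → subtermAt rt q' ≡ just (fun f us))
    classT-inv-fun Q {q'} e h with classify-inPattern rt (stripPrefix p Q) e
    ... | e1 , e2 = stripPrefix-just p Q e1 ,
                    walkToVar-nothing⇒fun rt q' σ e2 (subst (T ∘ is-just) (t-below-p q') (subst (T ∘ isPos t) (stripPrefix-just p Q e1) h))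

    classT-inv-ctx : ∀ Q → classT Q ≡ inContext → stripPrefix p Q ≡ nothing
    classT-inv-ctx Q e = classify-inContext rt (stripPrefix p Q) e

    lhs-fun : Σ Sym λ f → Σ (Vec Term (arity f)) λ us → lt ≡ fun f us
    lhs-fun = go lt (Rule.lhs-nonvar ρ)
      where
        go : (u : Term) → NonVar u → Σ Sym λ f → Σ (Vec Term (arity f)) λ us → u ≡ fun f us
        go (fun f us) _ = f , us , refl

    classS-root : classS p ≡ inPattern []
    classS-root rewrite stripPrefix-self p with lhs-fun
    ... | f , us , e rewrite e = refl

    α-match : ∀ a → hV α (hV m a) ≡ old a
    α-match a = proj₁ α∘m a

    α-pattern : ∀ q hl h → hV α (sVertex (p ++ q) h) ≡ old (vertexAt lt q hl)
    α-pattern q hl h = trans (cong (hV α) (sym (match-vertexAt q hl h))) (α-match _)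

    α-root : ∀ Q h → Q ≡ p → hV α (sVertex Q h) ≡ old rootL
    α-root Q h eq = trans (cong (hV α) (vertexAt-cong s (trans eq (sym (++-identityʳ p))) h (isPos-match [] tt)))
                          (α-pattern [] tt (isPos-match [] tt))

    α-outside-not-old : ∀ Q h a → stripPrefix p Q ≡ nothing → hV α (sVertex Q h) ≡ old a → Empty
    α-outside-not-old Q h a e eα with α-old⇒matched (sVertex Q h) a eα
    ... | ev with trans (cong (stripPrefix p) (trans (sym (vertexPos-vertexAt s linS Q h))
                   (trans (cong (vertexPos s) ev)
                   (trans (cong (λ z → vertexPos s (hV m z)) (sym (vertexAt-vertexPos lt a (vertexPos-isPos lt a))))
                          (matchPos (vertexPos lt a) (vertexPos-isPos lt a)))))) (stripPrefix-++ p (vertexPos lt a))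
    ... | e2 with trans (sym e) e2
    ... | ()

    α-edge-from-prm : ∀ e w o → hV α (src So e) ≡ prm w o → (hV α (tgt So e) ≡ prm w o) × (hE α e ≡ prmLp w o)
    α-edge-from-prm e w o h = trans (h-tgt α e) (cong (tgt L') out) , out
      where out = closure-out-prm _ (hE α e) (trans (sym (h-src α e)) h)

    α-edge-from-var : ∀ e x o → hV α (src So e) ≡ old (inj₂ (x , o)) →
                      (hV α (tgt So e) ≡ prm (inj₂ (x , o)) tt) × (hE α e ≡ toPrm (inj₂ (x , o)) tt)
    α-edge-from-var e x o h = trans (h-tgt α e) (cong (tgt L') out) , out
      where out = closure-out-var lt (hE α e) (trans (sym (h-src α e)) h)

    α-edge-from-ctx : ∀ e → hV α (src So e) ≡ ctxV →
                      ((hV α (tgt So e) ≡ ctxV) × (hE α e ≡ ctxLp)) ⊎ ((hV α (tgt So e) ≡ old rootL) × (hE α e ≡ toRoot))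
    α-edge-from-ctx e h with closure-out-ctx _ (hE α e) (trans (sym (h-src α e)) h)
    ... | inj₁ out = inj₁ (trans (h-tgt α e) (cong (tgt L') out) , out)
    ... | inj₂ out = inj₂ (trans (h-tgt α e) (cong (tgt L') out) , out)

    sEdge : ∀ Q j → T (isPos s (Q ++ [ j ])) → TE s
    sEdge Q j b = Q , j , isFun-intro s Q (proj₂ (proj₂ (parent-is-fun s Q j b))) , b

    sEdge-src : ∀ Q j b h → src So (sEdge Q j b) ≡ sVertex Q h
    sEdge-src Q j b h = sym (vertexAt-fun s Q (proj₂ (proj₂ (parent-is-fun s Q j b))) h _)

    α-prm-descendants : ∀ rest Q h h' w o → hV α (sVertex Q h) ≡ prm w o → hV α (sVertex (Q ++ rest) h') ≡ prm w o
    α-prm-descendants [] Q h hh w o e = trans (cong (hV α) (vertexAt-cong s (++-identityʳ Q) hh h)) e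
    α-prm-descendants (j ∷ rest) Q h h' w o e =
      trans (cong (hV α) (vertexAt-cong s (sym (++-assoc Q [ j ] rest)) h' h2))
            (α-prm-descendants rest (Q ++ [ j ]) hc h2 w o
              (proj₁ (α-edge-from-prm (sEdge Q j hc) w o (trans (cong (hV α) (sEdge-src Q j hc h)) e))))
      where
        h2 : T (isPos s ((Q ++ [ j ]) ++ rest))
        h2 = subst (T ∘ isPos s) (sym (++-assoc Q [ j ] rest)) h'
        hc : T (isPos s (Q ++ [ j ]))
        hc = isPos-prefix s (Q ++ [ j ]) rest h2

    isPos-varPos-lhs : ∀ x → T (occurs x lt) → T (isPos lt (varPos lt x))
    isPos-varPos-lhs x o = isPos-intro lt (varPos lt x) (subtermAt-varPos lt x o)

    α-var : ∀ x o h → hV α (sVertex (p ++ varPos lt x) h) ≡ old (inj₂ (x , o))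
    α-var x o h = trans (α-pattern (varPos lt x) (isPos-varPos-lhs x o) h)
                        (cong old (vertexAt-var lt (varPos lt x) (subtermAt-varPos lt x o) (isPos-varPos-lhs x o) o))

    α-below-var : ∀ x o j rest h → hV α (sVertex (p ++ varPos lt x ++ (j ∷ rest)) h) ≡ prm (inj₂ (x , o)) tt
    α-below-var x o j rest h =
      trans (cong (hV α) (vertexAt-cong s eqQ h h2))
            (α-prm-descendants rest (Q0 ++ [ j ]) hc h2 _ _
              (proj₁ (α-edge-from-var (sEdge Q0 j hc) x o (trans (cong (hV α) (sEdge-src Q0 j hc h0)) (α-var x o h0)))))
      where
        Q0 = p ++ varPos lt x
        h0 : T (isPos s Q0)
        h0 = isPos-match (varPos lt x) (isPos-varPos-lhs x o)
        eqQ : p ++ varPos lt x ++ (j ∷ rest) ≡ (Q0 ++ [ j ]) ++ rest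
        eqQ = trans (sym (++-assoc p (varPos lt x) (j ∷ rest))) (sym (++-assoc Q0 [ j ] rest))
        h2 : T (isPos s ((Q0 ++ [ j ]) ++ rest))
        h2 = subst (T ∘ isPos s) eqQ h
        hc : T (isPos s (Q0 ++ [ j ]))
        hc = isPos-prefix s (Q0 ++ [ j ]) rest h2

    α-context-snoc : ∀ Q j → (stripPrefix p Q ≡ nothing → ∀ h → hV α (sVertex Q h) ≡ ctxV) →
                 stripPrefix p (Q ++ [ j ]) ≡ nothing → ∀ h → hV α (sVertex (Q ++ [ j ]) h) ≡ ctxV
    α-context-snoc Q j ih e h with α-edge-from-ctx (sEdge Q j h) (trans (cong (hV α) (sEdge-src Q j h hQ)) (ih (stripPrefix-parent p Q j e) hQ))
      where
        hQ : T (isPos s Q)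
        hQ = isPos-prefix s Q [ j ] h
    ... | inj₁ (x , _) = x
    ... | inj₂ (x , _) = ⊥-elim (α-outside-not-old (Q ++ [ j ]) h rootL e x)

    -- The root of s cannot be matched (it lies outside p), nor sent to a primed
    -- vertex x′: then so would all its descendants, p among them.
    α-context-root : stripPrefix p [] ≡ nothing → ∀ h → hV α (sVertex [] h) ≡ ctxV
    α-context-root e h with hV α (sVertex [] h) in eq
    ... | old a = ⊥-elim (α-outside-not-old [] h a e eq)
    ... | ctxV = refl
    ... | prm w o with trans (sym (α-prm-descendants p [] h isPos-p w o eq)) (α-root p isPos-p refl)
    ... | ()

    α-context : ∀ Q → stripPrefix p Q ≡ nothing → ∀ h → hV α (sVertex Q h) ≡ ctxV
    α-context = snoc-induction (λ Q → stripPrefix p Q ≡ nothing → ∀ h → hV α (sVertex Q h) ≡ ctxV) α-context-root α-context-snoc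

    -- α is forced by the shape of the closure: outside the match everything goes to 𝒞
    -- (its only edge into l° enters at the root, i.e. at p), matched positions go to l°,
    -- and positions strictly below a matched variable x go to x′.
    data αView (Q : Pos) (h : T (isPos s Q)) : Set where
      aCtx : stripPrefix p Q ≡ nothing → hV α (sVertex Q h) ≡ ctxV → αView Q h
      aOld : (q' : Pos) (hl : T (isPos lt q')) → Q ≡ p ++ q' → hV α (sVertex Q h) ≡ old (vertexAt lt q' hl) → αView Q h
      aPrm : (x : Var) (o : T (occurs x lt)) (j : ℕ) (rest : Pos) → Q ≡ p ++ varPos lt x ++ (j ∷ rest) →
             hV α (sVertex Q h) ≡ prm (inj₂ (x , o)) tt → αView Q h

    αview : ∀ Q h → αView Q h
    αview Q h with stripPrefix p Q in e
    ... | nothing = aCtx e (α-context Q e h)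
    ... | just q' = go (walkToVar lt q') refl
      where
        eQ : Q ≡ p ++ q'
        eQ = stripPrefix-just p Q e
        hq : T (isPos s (p ++ q'))
        hq = subst (T ∘ isPos s) eQ h
        go : (mw : Maybe (Var × Pos)) → walkToVar lt q' ≡ mw → αView Q h
        go nothing ew with walkToVar-nothing⇒fun lt q' σ ew (subst (T ∘ is-just) (s-below-p q') hq)
        ... | f , us , el = aOld q' hl eQ (trans (cong (hV α) (vertexAt-cong s eQ h hq)) (α-pattern q' hl hq))
          where hl = isPos-intro lt q' el
        go (just (x , rest)) ew with walkToVar-split lt q' ew
        ... | qx , e3 , e4 with linear-varPos lt linL x qx e4
        go (just (x , [])) ew | qx , e3 , e4 | refl =
          aOld q' hl eQ (trans (cong (hV α) (vertexAt-cong s eQ h hq)) (α-pattern q' hl hq))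
          where hl = isPos-intro lt q' (trans (cong (subtermAt lt) (trans e3 (++-identityʳ qx))) e4)
        go (just (x , (j ∷ rest'))) ew | qx , e3 , e4 | refl =
          aPrm x o j rest' eQ2 (trans (cong (hV α) (vertexAt-cong s eQ2 h (subst (T ∘ isPos s) eQ2 h))) (α-below-var x o j rest' _))
          where
            o = occ-at lt qx x e4
            eQ2 : Q ≡ p ++ varPos lt x ++ (j ∷ rest')
            eQ2 = trans eQ (cong (p ++_) e3)

    GK-commutes : ∀ w → hV α (hV gL w) ≡ hV l′ (hV u' w)
    GK-commutes w = proj₁ (IsPullback.commutes pb₂) w

    open PullbackElements pb₂

    sPos : V GK → Pos
    sPos w = vertexPos s (hV gL w)

    isPos-sPos : ∀ w → T (isPos s (sPos w))
    isPos-sPos w = vertexPos-isPos s (hV gL w)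

    gL-sPos : ∀ w → hV gL w ≡ sVertex (sPos w) (isPos-sPos w)
    gL-sPos w = sym (vertexAt-vertexPos s (hV gL w) (isPos-sPos w))

    α-sPos : ∀ w {k} → hV u' w ≡ k → hV α (sVertex (sPos w) (isPos-sPos w)) ≡ hV l′ k
    α-sPos w eu = trans (cong (hV α) (sym (gL-sPos w))) (trans (GK-commutes w) (cong (hV l′) eu))

    GK-context : ∀ w → hV u' w ≡ ctxV → stripPrefix p (sPos w) ≡ nothing
    GK-context w eu with αview (sPos w) (isPos-sPos w)
    ... | aCtx e _ = e
    ... | aOld q' hl eQ eα with trans (sym eα) (α-sPos w eu)
    ... | ()
    GK-context w eu | aPrm x o j rest eQ eα with trans (sym eα) (α-sPos w eu)
    ... | ()

    GK-root : ∀ w → hV u' w ≡ old (inj₁ tt) → sPos w ≡ p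
    GK-root w eu with αview (sPos w) (isPos-sPos w)
    ... | aCtx e eα with trans (sym eα) (α-sPos w eu)
    ... | ()
    GK-root w eu | aPrm x o j rest eQ eα with trans (sym eα) (α-sPos w eu)
    ... | ()
    GK-root w eu | aOld q' hl eQ eα = trans eQ (trans (cong (p ++_) q'≡) (++-identityʳ p))
      where
        q'≡ : q' ≡ []
        q'≡ = trans (sym (vertexPos-vertexAt lt linL q' hl))
                (trans (cong (vertexPos lt) (old-injective (trans (sym eα) (α-sPos w eu)))) (vertexPos-vertexAt lt linL [] tt))

    GK-var : ∀ w x o → hV u' w ≡ old (inj₂ (x , o)) → sPos w ≡ p ++ varPos lt x ++ []
    GK-var w x o eu with αview (sPos w) (isPos-sPos w)
    ... | aCtx e eα with trans (sym eα) (α-sPos w eu)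
    ... | ()
    GK-var w x o eu | aPrm y oy j rest eQ eα with trans (sym eα) (α-sPos w eu)
    ... | ()
    GK-var w x o eu | aOld q' hl eQ eα = trans eQ (cong (p ++_) (trans q'≡ (sym (++-identityʳ _))))
      where
        q'≡ : q' ≡ varPos lt x
        q'≡ = trans (sym (vertexPos-vertexAt lt linL q' hl)) (cong (vertexPos lt) (old-injective (trans (sym eα) (α-sPos w eu))))

    GK-prm : ∀ w x o o' → hV u' w ≡ prm (inj₂ (x , o)) o' → Σ ℕ λ j → Σ Pos λ rest → sPos w ≡ p ++ varPos lt x ++ (j ∷ rest)
    GK-prm w x o o' eu with αview (sPos w) (isPos-sPos w)
    ... | aCtx e eα with trans (sym eα) (α-sPos w eu)
    ... | ()
    GK-prm w x o o' eu | aOld q' hl eQ eα with trans (sym eα) (α-sPos w eu)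
    ... | ()
    GK-prm w x o o' eu | aPrm y oy j rest eQ eα with trans (sym eα) (α-sPos w eu)
    ... | refl = j , rest , eQ

    lK : Hom K Lo
    lK = PRule.l (ρ °R)

    rK : Hom K Ro
    rK = PRule.r (ρ °R)

    u-gL : ∀ k → hV gL (hV u k) ≡ hV m (hV lK k)
    u-gL k = proj₁ u-l k

    u-u' : ∀ k → hV u' (hV u k) ≡ old k
    u-u' k = proj₁ u-tK k

    -- Of the pattern positions only the root p survives in G_K (function symbols of l are
    -- deleted); context positions stay, and positions below x in l move below x in r.
    translateClass : PosClass → Pos → Pos
    translateClass inContext Q = Q
    translateClass (inPattern _) Q = p
    translateClass (belowVar x R) Q = p ++ varPos rt x ++ R

    translate : Pos → Pos
    translate Q = translateClass (classS Q) Q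

    translate-context : ∀ Q → stripPrefix p Q ≡ nothing → translate Q ≡ Q
    translate-context Q e = cong (λ c → translateClass c Q) (classS-ctx Q e)

    translate-root : translate p ≡ p
    translate-root = cong (λ c → translateClass c p) classS-root

    translate-var : ∀ x → T (occurs x lt) → ∀ R → translate (p ++ varPos lt x ++ R) ≡ p ++ varPos rt x ++ R
    translate-var x o R = cong (λ c → translateClass c (p ++ varPos lt x ++ R)) (classS-var x o R)

    q₁Pos : V GK → Pos
    q₁Pos w = translate (sPos w)

    data q₁View (w : V GK) : Set where
      atRoot : hV u' w ≡ old (inj₁ tt) → q₁Pos w ≡ p → q₁View w
      sameShape : shape (subtermAt t (q₁Pos w)) ≡ shape (subtermAt s (sPos w)) → q₁View w

    q₁view : ∀ w → q₁View w
    q₁view w with hV u' w in eu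
    ... | old (inj₁ tt) = atRoot eu (trans (cong translate (GK-root w eu)) translate-root)
    ... | old (inj₂ (x , o)) = sameShape (subst (λ Q → shape (subtermAt t (translate Q)) ≡ shape (subtermAt s Q)) (sym (GK-var w x o eu))
                                  (trans (cong (shape ∘ subtermAt t) (translate-var x (Rule.vars⊆ ρ x o) []))
                                         (cong shape (t≈s-below-var x o []))))
    ... | prm (inj₁ tt) ()
    ... | prm (inj₂ (x , o)) o' with GK-prm w x o o' eu
    ... | j , rest , eQ = sameShape (subst (λ Q → shape (subtermAt t (translate Q)) ≡ shape (subtermAt s Q)) (sym eQ)
                                  (trans (cong (shape ∘ subtermAt t) (translate-var x (Rule.vars⊆ ρ x o) (j ∷ rest)))
                                         (cong shape (t≈s-below-var x o (j ∷ rest)))))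
    q₁view w | ctxV = sameShape (trans (cong (shape ∘ subtermAt t) (translate-context (sPos w) (GK-context w eu))) (t-outside-p (sPos w) (GK-context w eu)))

    q₁-isPos : ∀ w → T (isPos t (q₁Pos w))
    q₁-isPos w with q₁view w
    ... | atRoot _ e = subst (T ∘ isPos t) (sym e) isPos-t-p
    ... | sameShape e = shape-isPos t s (q₁Pos w) (sPos w) e (isPos-sPos w)

    q₁V : V GK → V (t °)
    q₁V w = vertexAt t (q₁Pos w) (q₁-isPos w)

    lV-gL-sPos : ∀ w → lV So (hV gL w) ≡ labelOf (subtermAt s (sPos w))
    lV-gL-sPos w = trans (cong (lV So) (gL-sPos w)) (lV-vertexAt s (sPos w) (isPos-sPos w))

    q₁-lab′ : ∀ w → q₁View w → lV GK w ≤L labelOf (subtermAt t (q₁Pos w))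
    q₁-lab′ w (atRoot eu _) = ≤bot⇒≤ _ (subst (λ k → lV GK w ≤L lV K' k) eu (h-lV u' w))
    q₁-lab′ w (sameShape e) = ≤L-subst refl (trans (lV-gL-sPos w) (shape-labelOf t s (q₁Pos w) (sPos w) e)) (h-lV gL w)

    q₁-lab : ∀ w → lV GK w ≤L lV (t °) (q₁V w)
    q₁-lab w = ≤L-subst refl (sym (lV-vertexAt t (q₁Pos w) (q₁-isPos w))) (q₁-lab′ w (q₁view w))

    sPos-src : ∀ we → sPos (src GK we) ≡ proj₁ (hE gL we)
    sPos-src we = cong (vertexPos s) (h-src gL we)

    sPos-tgt : ∀ we → sPos (tgt GK we) ≡ sPos (src GK we) ++ [ proj₁ (proj₂ (hE gL we)) ]
    sPos-tgt we = trans (cong (vertexPos s) (h-tgt gL we))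
                  (trans (vertexPos-vertexAt s linS _ _) (cong (_++ [ proj₁ (proj₂ (hE gL we)) ]) (sym (sPos-src we))))

    translate-snoc : ∀ x → T (occurs x lt) → ∀ R j → translate ((p ++ varPos lt x ++ R) ++ [ j ]) ≡ translate (p ++ varPos lt x ++ R) ++ [ j ]
    translate-snoc x o R j = trans (cong translate (++-assoc₃ p (varPos lt x) R j))
                           (trans (translate-var x o (R ++ [ j ]))
                           (trans (sym (++-assoc₃ p (varPos rt x) R j)) (cong (_++ [ j ]) (sym (translate-var x o R)))))

    q₁Pos-tgt : ∀ we → q₁Pos (tgt GK we) ≡ q₁Pos (src GK we) ++ [ proj₁ (proj₂ (hE gL we)) ]
    q₁Pos-tgt we = go (hE u' we) (h-src u' we) (h-tgt u' we)
      where
        j = proj₁ (proj₂ (hE gL we))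
        Pt : sPos (tgt GK we) ≡ sPos (src GK we) ++ [ j ]
        Pt = sPos-tgt we
        goal = translate (sPos (tgt GK we)) ≡ translate (sPos (src GK we)) ++ [ j ]
        viaR : ∀ x o R → sPos (src GK we) ≡ p ++ varPos lt x ++ R → goal
        viaR x o R eq = trans (cong translate (trans Pt (cong (_++ [ j ]) eq)))
                         (trans (translate-snoc x o R j) (cong (λ z → translate z ++ [ j ]) (sym eq)))
        go : (ke : E K') → hV u' (src GK we) ≡ src K' ke → hV u' (tgt GK we) ≡ tgt K' ke → goal
        go (oldE ())
        go (toPrm (inj₁ tt) ())
        go (toPrm (inj₂ (x , o)) o') es et = viaR x (Rule.vars⊆ ρ x o) [] (GK-var (src GK we) x o es)
        go (prmLp (inj₁ tt) ())
        go (prmLp (inj₂ (x , o)) o') es et with GK-prm (src GK we) x o o' es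
        ... | j' , rest , eq = viaR x (Rule.vars⊆ ρ x o) (j' ∷ rest) eq
        go toRoot es et = trans (cong translate (GK-root (tgt GK we) et))
                           (trans translate-root (trans (sym (GK-root (tgt GK we) et))
                           (trans Pt (cong (_++ [ j ]) (sym (translate-context _ (GK-context (src GK we) es)))))))
        go ctxLp es et = trans (translate-context _ (GK-context (tgt GK we) et))
                          (trans Pt (cong (_++ [ j ]) (sym (translate-context _ (GK-context (src GK we) es)))))

    q₁-isPos-child : ∀ we → T (isPos t (q₁Pos (src GK we) ++ [ proj₁ (proj₂ (hE gL we)) ]))
    q₁-isPos-child we = subst (T ∘ isPos t) (q₁Pos-tgt we) (q₁-isPos (tgt GK we))

    q₁-parent-fun : ∀ we → Σ Sym λ f → Σ (Vec Term (arity f)) λ us → subtermAt t (q₁Pos (src GK we)) ≡ just (fun f us)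
    q₁-parent-fun we = parent-is-fun t (q₁Pos (src GK we)) (proj₁ (proj₂ (hE gL we))) (q₁-isPos-child we)

    q₁E : E GK → TE t
    q₁E we = q₁Pos (src GK we) , proj₁ (proj₂ (hE gL we)) ,
             isFun-intro t (q₁Pos (src GK we)) (proj₂ (proj₂ (q₁-parent-fun we))) , q₁-isPos-child we

    q₁ : Hom GK (t °)
    q₁ = record
      { hV = q₁V ; hE = q₁E
      ; h-src = λ we → vertexAt-fun t _ (proj₂ (proj₂ (q₁-parent-fun we))) (q₁-isPos (src GK we)) _
      ; h-tgt = λ we → vertexAt-cong t (q₁Pos-tgt we) _ _
      ; h-lV = q₁-lab
      ; h-lE = λ we → h-lE gL we }

    isPos-t-rhs : ∀ q → T (isPos rt q) → T (isPos t (p ++ q))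
    isPos-t-rhs q h = subst (T ∘ is-just) (sym (t-below-p q)) (isPos-⟨⟩ rt q σ h)

    q₂V : V Ro → V (t °)
    q₂V v = vertexAt t (p ++ vertexPos rt v) (isPos-t-rhs _ (vertexPos-isPos rt v))

    q₂-fun : ∀ q a → Σ Sym λ f → Σ (Vec Term (arity f)) λ us → subtermAt t (p ++ q) ≡ just (fun f us)
    q₂-fun q a with isFun-elim rt q a
    ... | f , us , e = f , substArgs us σ , trans (t-below-p q) (subtermAt-⟨⟩-fun rt q σ e)

    q₂E : TE rt → TE t
    q₂E (q , j , a , b) = p ++ q , j , isFun-intro t (p ++ q) (proj₂ (proj₂ (q₂-fun q a))) ,
                          subst (T ∘ isPos t) (sym (++-assoc p q [ j ])) (isPos-t-rhs _ b)

    q₂-lab : ∀ v → lV Ro v ≤L lV (t °) (q₂V v)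
    q₂-lab v = ≤L-subst (sym (trans (cong (lV Ro) (sym (vertexAt-vertexPos rt v (vertexPos-isPos rt v)))) (lV-vertexAt rt _ _)))
                        (trans (sym (cong labelOf (t-below-p (vertexPos rt v)))) (sym (lV-vertexAt t _ _)))
                        (labelOf-⟨⟩ rt (vertexPos rt v) σ)

    q₂ : Hom Ro (t °)
    q₂ = record
      { hV = q₂V ; hE = q₂E
      ; h-src = λ { (q , j , a , b) → vertexAt-fun t _ (proj₂ (proj₂ (q₂-fun q a))) _ _ }
      ; h-tgt = λ { (q , j , a , b) → vertexAt-cong t (trans (cong (p ++_) (vertexPos-vertexAt rt linR (q ++ [ j ]) b)) (sym (++-assoc p q [ j ]))) _ _ }
      ; h-lV = q₂-lab
      ; h-lE = λ _ → refl≤ }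

    q-commutes : (q₁ ∘H u) ≈H (q₂ ∘H rK)
    q-commutes = cv , (λ ())
      where
        cv : ∀ k → q₁V (hV u k) ≡ q₂V (hV rK k)
        cv (inj₁ tt) = vertexAt-cong t (trans (cong translate (GK-root _ (u-u' (inj₁ tt))))
                          (trans translate-root (trans (sym (++-identityʳ p)) (cong (p ++_) (sym (vertexPos-vertexAt rt linR [] tt)))))) _ _
        cv (inj₂ (x , o)) = vertexAt-cong t (trans (cong translate (GK-var _ x o (u-u' (inj₂ (x , o)))))
                          (trans (translate-var x (Rule.vars⊆ ρ x o) []) (cong (p ++_) (++-identityʳ _)))) _ _

    data tVarView (Tp : Pos) (y : Var) : Set where
      varInContext : stripPrefix p Tp ≡ nothing → subtermAt s Tp ≡ just (var y) → tVarView Tp y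
      varBelowVar : (x : Var) (o : T (occurs x rt)) (R : Pos) → Tp ≡ p ++ varPos rt x ++ R →
              subtermAt s (p ++ varPos lt x ++ R) ≡ just (var y) → tVarView Tp y

    tvarview : ∀ Tp y → subtermAt t Tp ≡ just (var y) → tVarView Tp y
    tvarview Tp y e with classT Tp in c
    ... | inContext = varInContext d (shape-var _ (trans (sym (t-outside-p Tp d)) (cong shape e)))
      where d = classT-inv-ctx Tp c
    ... | inPattern q' with classT-inv-fun Tp c (isPos-intro t Tp e)
    ... | eT , f , us , er with trans (sym e) (trans (cong (subtermAt t) eT) (trans (t-below-p q') (subtermAt-⟨⟩-fun rt q' σ er)))
    ... | ()
    tvarview Tp y e | belowVar x R with classT-inv-var Tp c
    ... | eT , o = varBelowVar x o R eT (trans (sym (t≈s-below-var x o R)) (trans (cong (subtermAt t) (sym eT)) e))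

    t-var-position-unique : ∀ P₁ P₂ y → subtermAt t P₁ ≡ just (var y) → subtermAt t P₂ ≡ just (var y) → P₁ ≡ P₂
    t-var-position-unique P₁ P₂ y e1 e2 = go (tvarview P₁ y e1) (tvarview P₂ y e2)
      where
        cnt = linS y
        go : tVarView P₁ y → tVarView P₂ y → P₁ ≡ P₂
        go (varInContext d1 s1) (varInContext d2 s2) = var-position-unique s y P₁ P₂ cnt s1 s2
        go (varInContext d1 s1) (varBelowVar x o R eT s2)
          with trans (sym d1) (trans (cong (stripPrefix p) (var-position-unique s y P₁ _ cnt s1 s2)) (stripPrefix-++ p _))
        ... | ()
        go (varBelowVar x o R eT s1) (varInContext d2 s2)
          with trans (sym d2) (trans (cong (stripPrefix p) (var-position-unique s y P₂ _ cnt s2 s1)) (stripPrefix-++ p _))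
        ... | ()
        go (varBelowVar x1 o1 R₁ eT1 s1) (varBelowVar x2 o2 R₂ eT2 s2)
          with trans (sym (classS-var x1 (Rule.vars⊆ ρ x1 o1) R₁))
                     (trans (cong classS (var-position-unique s y _ _ cnt s1 s2)) (classS-var x2 (Rule.vars⊆ ρ x2 o2) R₂))
        ... | refl = trans eT1 (sym eT2)

    t-linear-varPos : ∀ x q → subtermAt t q ≡ just (var x) → q ≡ varPos t x
    t-linear-varPos x q e = t-var-position-unique q (varPos t x) x e (subtermAt-varPos t x (occ-at t q x e))

    vertexPos-vertexAt-t : ∀ q h → vertexPos t (vertexAt t q h) ≡ q
    vertexPos-vertexAt-t q h = go (subtermAt t q) refl
      where
        go : (mt : Maybe Term) → subtermAt t q ≡ mt → vertexPos t (vertexAt t q h) ≡ q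
        go (just (fun f us)) e rewrite vertexAt-fun t q e h (isFun-intro t q e) = refl
        go (just (var x)) e rewrite vertexAt-var t q e h (occ-at t q x e) = sym (t-linear-varPos x q e)
        go nothing e = ⊥-elim (subst (T ∘ is-just) e h)

    varNode : (x : Var) → T (occurs x rt) → Pos → V K'
    varNode x o [] = old (inj₂ (x , o))
    varNode x o (_ ∷ _) = prm (inj₂ (x , o)) tt

    varNode-snoc : ∀ x o R j → varNode x o (R ++ [ j ]) ≡ prm (inj₂ (x , o)) tt
    varNode-snoc x o [] j = refl
    varNode-snoc x o (_ ∷ R) j = refl

    α-varNode : ∀ x o R h → hV α (sVertex (p ++ varPos lt x ++ R) h) ≡ hV l′ (varNode x o R)
    α-varNode x o [] h = trans (cong (hV α) (vertexAt-cong s (cong (p ++_) (++-identityʳ _)) h (isPos-match _ (isPos-varPos-lhs x o')))) (α-var x o' _)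
      where o' = Rule.vars⊆ ρ x o
    α-varNode x o (j ∷ R) h = α-below-var x (Rule.vars⊆ ρ x o) j R h

    isPos-s-belowVar : ∀ Tp x o R → Tp ≡ p ++ varPos rt x ++ R → T (isPos t Tp) → T (isPos s (p ++ varPos lt x ++ R))
    isPos-s-belowVar Tp x o R eT h = subst (T ∘ is-just) (trans (cong (subtermAt t) eT) (t≈s-below-var x o R)) h

    isPos-s-context : ∀ Tp → stripPrefix p Tp ≡ nothing → T (isPos t Tp) → T (isPos s Tp)
    isPos-s-context Tp d h = shape-isPos s t Tp Tp (sym (t-outside-p Tp d)) h

    fromClass : (Tp : Pos) → T (isPos t Tp) → (c : PosClass) → classT Tp ≡ c → V G
    fromClass Tp h inContext e = hV gR (vertexPair (sVertex Tp hs) ctxV (α-context Tp d hs))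
      where
        d = classT-inv-ctx Tp e
        hs = isPos-s-context Tp d h
    fromClass Tp h (inPattern q') e = hV n (vertexAt rt q' (isPos-intro rt q' (proj₂ (proj₂ (proj₂ (classT-inv-fun Tp e h))))))
    fromClass Tp h (belowVar x R) e = hV gR (vertexPair (sVertex _ hs) (varNode x o R) (α-varNode x o R hs))
      where
        o = proj₂ (classT-inv-var Tp e)
        hs = isPos-s-belowVar Tp x o R (proj₁ (classT-inv-var Tp e)) h

    fromV : V (t °) → V G
    fromV v = fromClass (vertexPos t v) (vertexPos-isPos t v) (classT (vertexPos t v)) refl

    fromClass-irrelevant : ∀ P₁ P₂ → P₁ ≡ P₂ → ∀ h1 h2 c e → fromClass P₁ h1 (classT P₁) refl ≡ fromClass P₂ h2 c e
    fromClass-irrelevant P₁ .P₁ refl h1 h2 .(classT P₁) refl rewrite T-irrelevant h1 h2 = refl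

    fromV-vertexAt : ∀ Tp h c e → fromV (vertexAt t Tp h) ≡ fromClass Tp h c e
    fromV-vertexAt Tp h c e = fromClass-irrelevant _ Tp (vertexPos-vertexAt-t Tp h) _ h c e

    gR-u : ∀ k → hV gR (hV u k) ≡ hV n (hV rK k)
    gR-u k = proj₁ (IsPushout.commutes po) k

    fromClass-context : ∀ Tp h e w → vertexPos s (hV gL w) ≡ Tp → hV u' w ≡ ctxV → fromClass Tp h inContext e ≡ hV gR w
    fromClass-context Tp h e w ep eu =
      cong (hV gR) (sym (vertexPair-unique _ _ _ w (trans (gL-sPos w) (vertexAt-cong s ep _ _)) eu))

    fromClass-var : ∀ Tp h x R e w → vertexPos s (hV gL w) ≡ p ++ varPos lt x ++ R → (∀ o → hV u' w ≡ varNode x o R) →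
                   fromClass Tp h (belowVar x R) e ≡ hV gR w
    fromClass-var Tp h x R e w ep eu =
      cong (hV gR) (sym (vertexPair-unique _ _ _ w (trans (gL-sPos w) (vertexAt-cong s ep _ _)) (eu _)))

    u′-varNode : ∀ x o o' → hV u' (hV u (inj₂ (x , o))) ≡ varNode x o' []
    u′-varNode x o o' = trans (u-u' (inj₂ (x , o))) (cong (λ z → old (inj₂ (x , z))) (T-irrelevant o o'))

    gR-root : ∀ w → hV u' w ≡ old (inj₁ tt) → hV gR w ≡ hV n (vertexAt rt [] tt)
    gR-root w eu = trans (cong (hV gR) (trans e1 (sym e2))) (gR-u (inj₁ tt))
      where
        ew = trans (GK-commutes w) (cong (hV l′) eu)
        e1 : w ≡ vertexPair (hV gL w) (old (inj₁ tt)) ew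
        e1 = vertexPair-unique _ _ ew w refl eu
        gl : hV gL (hV u (inj₁ tt)) ≡ hV gL w
        gl = trans (u-gL (inj₁ tt))
               (trans (match-vertexAt [] tt validP')
               (trans (vertexAt-cong s (trans (++-identityʳ p) (sym (GK-root w eu))) validP' (isPos-sPos w)) (sym (gL-sPos w))))
          where validP' = isPos-match [] tt
        e2 : hV u (inj₁ tt) ≡ vertexPair (hV gL w) (old (inj₁ tt)) ew
        e2 = vertexPair-unique _ _ ew _ gl (u-u' (inj₁ tt))

    classT-pattern : ∀ q' {f us} → subtermAt rt q' ≡ just (fun f us) → classT (p ++ q') ≡ inPattern q'
    classT-pattern q' e rewrite stripPrefix-++ p q' | walkToVar-fun rt q' e = refl

    fromV-rhs : ∀ q' hr ht → fromV (vertexAt t (p ++ q') ht) ≡ hV n (vertexAt rt q' hr)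
    fromV-rhs q' hr ht = go (subtermAt rt q') refl
      where
        go : (mt : Maybe Term) → subtermAt rt q' ≡ mt → fromV (vertexAt t (p ++ q') ht) ≡ hV n (vertexAt rt q' hr)
        go (just (fun f us)) er = trans (fromV-vertexAt _ ht (inPattern q') (classT-pattern q' er)) (cong (hV n) (vertexAt-cong rt refl _ _))
        go (just (var x)) er =
          trans (fromV-vertexAt _ ht (belowVar x []) ec)
            (trans (fromClass-var _ ht x [] ec (hV u (inj₂ (x , o))) (GK-var _ x o (u-u' _)) (u′-varNode x o))
            (trans (gR-u (inj₂ (x , o))) (cong (hV n) (sym (vertexAt-var rt q' er hr o)))))
          where
            o = occ-at rt q' x er
            eq' : p ++ q' ≡ p ++ varPos rt x ++ []
            eq' = cong (p ++_) (trans (linear-varPos rt linR x q' er) (sym (++-identityʳ _)))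
            ec : classT (p ++ q') ≡ belowVar x []
            ec = trans (cong classT eq') (classT-var x o [])
        go nothing er = ⊥-elim (subst (T ∘ is-just) er hr)

    varNode-top : ∀ lab x o R → lab ≤L lV K' (varNode x o R)
    varNode-top lab x o [] = ≤top
    varNode-top lab x o (_ ∷ _) = ≤top

    fromClass-lab : ∀ Tp h c e → lV (t °) (vertexAt t Tp h) ≤L lV G (fromClass Tp h c e)
    fromClass-lab Tp h inContext e =
      ≤L-trans (vertexPair-lab _ (sVertex Tp hs) ctxV _ (≤L-subst refl labEq refl≤) ≤top) (h-lV gR _)
      where
        d = classT-inv-ctx Tp e
        hs = isPos-s-context Tp d h
        labEq : lV (t °) (vertexAt t Tp h) ≡ lV So (sVertex Tp hs)
        labEq = trans (lV-vertexAt t Tp h) (trans (shape-labelOf s t Tp Tp (sym (t-outside-p Tp d))) (sym (lV-vertexAt s Tp hs)))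
    fromClass-lab Tp h (inPattern q') e with classT-inv-fun Tp e h
    ... | eT , f , us , er =
      ≤L-subst (sym labEq) refl (h-lV n (vertexAt rt q' (isPos-intro rt q' (proj₂ (proj₂ (proj₂ (classT-inv-fun Tp e h)))))))
      where
        labEq : lV (t °) (vertexAt t Tp h) ≡ lV Ro (vertexAt rt q' (isPos-intro rt q' (proj₂ (proj₂ (proj₂ (classT-inv-fun Tp e h))))))
        labEq = trans (lV-vertexAt t Tp h)
                  (trans (cong labelOf (trans (cong (subtermAt t) eT) (trans (t-below-p q') (subtermAt-⟨⟩-fun rt q' σ er))))
                  (sym (trans (lV-vertexAt rt q' _) (cong labelOf er))))
    fromClass-lab Tp h (belowVar x R) e =
      ≤L-trans (vertexPair-lab _ (sVertex _ hs) (varNode x o R) _ (≤L-subst refl labEq refl≤) (varNode-top _ x o R)) (h-lV gR _)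
      where
        o = proj₂ (classT-inv-var Tp e)
        eT = proj₁ (classT-inv-var Tp e)
        hs = isPos-s-belowVar Tp x o R eT h
        labEq : lV (t °) (vertexAt t Tp h) ≡ lV So (sVertex _ hs)
        labEq = trans (lV-vertexAt t Tp h)
                  (trans (cong labelOf (trans (cong (subtermAt t) eT) (t≈s-below-var x o R))) (sym (lV-vertexAt s _ hs)))

    varEdge : (x : Var) → T (occurs x rt) → Pos → E K'
    varEdge x o [] = toPrm (inj₂ (x , o)) tt
    varEdge x o (_ ∷ _) = prmLp (inj₂ (x , o)) tt

    varEdge-src : ∀ x o R → src K' (varEdge x o R) ≡ varNode x o R
    varEdge-src x o [] = refl
    varEdge-src x o (_ ∷ _) = refl

    varEdge-tgt : ∀ x o R → tgt K' (varEdge x o R) ≡ prm (inj₂ (x , o)) tt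
    varEdge-tgt x o [] = refl
    varEdge-tgt x o (_ ∷ _) = refl

    varEdge-top : ∀ lab x o R → lab ≤L lE K' (varEdge x o R)
    varEdge-top lab x o [] = ≤top
    varEdge-top lab x o (_ ∷ _) = ≤top

    α-sEdge-src : ∀ Q j bs → hV α (src So (sEdge Q j bs)) ≡ hV α (sVertex Q (isPos-prefix s Q [ j ] bs))
    α-sEdge-src Q j bs = cong (hV α) (sEdge-src Q j bs _)

    α-varEdge : ∀ x o R j bs → hE α (sEdge (p ++ varPos lt x ++ R) j bs) ≡ hE l′ (varEdge x o R)
    α-varEdge x o [] j bs = proj₂ (α-edge-from-var (sEdge _ j bs) x (Rule.vars⊆ ρ x o) (trans (α-sEdge-src _ j bs) (α-varNode x o [] _)))
    α-varEdge x o (j' ∷ R) j bs = proj₂ (α-edge-from-prm (sEdge _ j bs) _ _ (trans (α-sEdge-src _ j bs) (α-varNode x o (j' ∷ R) _)))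

    α-contextEdge : ∀ Q j bs → stripPrefix p Q ≡ nothing → stripPrefix p (Q ++ [ j ]) ≡ nothing → hE α (sEdge Q j bs) ≡ ctxLp
    α-contextEdge Q j bs d1 d2 with α-edge-from-ctx (sEdge Q j bs) (trans (α-sEdge-src Q j bs) (α-context Q d1 _))
    ... | inj₁ (_ , e) = e
    ... | inj₂ (x , _) = ⊥-elim (α-outside-not-old (Q ++ [ j ]) bs rootL d2 x)

    α-rootEdge : ∀ Q j bs → stripPrefix p Q ≡ nothing → Q ++ [ j ] ≡ p → hE α (sEdge Q j bs) ≡ toRoot
    α-rootEdge Q j bs d1 eq with α-edge-from-ctx (sEdge Q j bs) (trans (α-sEdge-src Q j bs) (α-context Q d1 _))
    ... | inj₂ (_ , e) = e
    ... | inj₁ (x , _) with trans (sym x) (α-root (Q ++ [ j ]) bs eq)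
    ... | ()

    argAt-⟨⟩ : ∀ {k} (us : Vec Term k) j → argAt (substArgs us σ) j [] ≡ mapM (_⟨ σ ⟩) (argAt us j [])
    argAt-⟨⟩ [] j = refl
    argAt-⟨⟩ (u0 ∷ us) zero = refl
    argAt-⟨⟩ (u0 ∷ us) (suc j) = argAt-⟨⟩ us j

    is-just-map-⟨⟩ : ∀ (mt : Maybe Term) → is-just (mapM (_⟨ σ ⟩) mt) ≡ is-just mt
    is-just-map-⟨⟩ nothing = refl
    is-just-map-⟨⟩ (just _) = refl

    isPos-rhs-child : ∀ Tp j q' {f us} → Tp ≡ p ++ q' → subtermAt rt q' ≡ just (fun f us) → T (isPos t (Tp ++ [ j ])) → T (isPos rt (q' ++ [ j ]))
    isPos-rhs-child Tp j q' {f} {us} eT er b =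
      subst T (trans (cong is-just e2) (trans (is-just-map-⟨⟩ _) (cong is-just (sym e1)))) b
      where
        e1 : subtermAt rt (q' ++ [ j ]) ≡ argAt us j []
        e1 = subtermAt-++ rt q' [ j ] er
        e2 : subtermAt t (Tp ++ [ j ]) ≡ mapM (_⟨ σ ⟩) (argAt us j [])
        e2 = trans (cong (λ z → subtermAt t (z ++ [ j ])) eT)
              (trans (cong (subtermAt t) (++-assoc p q' [ j ]))
              (trans (t-below-p _) (trans (subtermAt-++ (rt ⟨ σ ⟩) q' [ j ] (subtermAt-⟨⟩-fun rt q' σ er)) (argAt-⟨⟩ us j))))

    isPos-s-belowVar-child : ∀ Tp j x o R → Tp ≡ p ++ varPos rt x ++ R → T (isPos t (Tp ++ [ j ])) → T (isPos s ((p ++ varPos lt x ++ R) ++ [ j ]))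
    isPos-s-belowVar-child Tp j x o R eT b =
      subst (T ∘ is-just)
        (trans (cong (λ z → subtermAt t (z ++ [ j ])) eT)
        (trans (cong (subtermAt t) (++-assoc₃ p (varPos rt x) R j))
        (trans (t≈s-below-var x o (R ++ [ j ])) (cong (subtermAt s) (sym (++-assoc₃ p (varPos lt x) R j)))))) b

    rhsEdge : ∀ Tp j (b : T (isPos t (Tp ++ [ j ]))) q' → classT Tp ≡ inPattern q' → TE rt
    rhsEdge Tp j b q' e = q' , j , isFun-intro rt q' er , isPos-rhs-child Tp j q' eT er b
      where
        inv = classT-inv-fun Tp e (isPos-prefix t Tp [ j ] b)
        eT = proj₁ inv
        er = proj₂ (proj₂ (proj₂ inv))

    fromEdgeClass : (Tp : Pos) (j : ℕ) (b : T (isPos t (Tp ++ [ j ]))) (c : PosClass) → classT Tp ≡ c →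
             (d : Maybe Pos) → stripPrefix p (Tp ++ [ j ]) ≡ d → E G
    fromEdgeClass Tp j b inContext e nothing ed = hE gR (edgePair (sEdge Tp j bs) ctxLp (α-contextEdge Tp j bs (classT-inv-ctx Tp e) ed))
      where bs = isPos-s-context (Tp ++ [ j ]) ed b
    fromEdgeClass Tp j b inContext e (just r') ed = hE gR (edgePair (sEdge Tp j bs) toRoot (α-rootEdge Tp j bs d1 eqp))
      where
        d1 = classT-inv-ctx Tp e
        eqp = stripPrefix-enter p Tp j d1 ed
        bs = subst (T ∘ isPos s) (sym eqp) isPos-p
    fromEdgeClass Tp j b (inPattern q') e d ed = hE n (rhsEdge Tp j b q' e)
    fromEdgeClass Tp j b (belowVar x R) e d ed = hE gR (edgePair (sEdge _ j bs) (varEdge x o R) (α-varEdge x o R j bs))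
      where
        o = proj₂ (classT-inv-var Tp e)
        bs = isPos-s-belowVar-child Tp j x o R (proj₁ (classT-inv-var Tp e)) b

    fromE : TE t → E G
    fromE (Tp , j , a , b) = fromEdgeClass Tp j b (classT Tp) refl (stripPrefix p (Tp ++ [ j ])) refl

    fromE-edge : ∀ Tp j a b c (e : classT Tp ≡ c) d (ed : stripPrefix p (Tp ++ [ j ]) ≡ d) → fromE (Tp , j , a , b) ≡ fromEdgeClass Tp j b c e d ed
    fromE-edge Tp j a b .(classT Tp) refl .(stripPrefix p (Tp ++ [ j ])) refl = refl

    srcG : ∀ e k eq → src G (hE gR (edgePair e k eq)) ≡ hV gR (vertexPair (src So e) (src K' k) (src-compatible e k eq))
    srcG e k eq = trans (sym (h-src gR _)) (cong (hV gR) (edgePair-src e k eq))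

    tgtG : ∀ e k eq → tgt G (hE gR (edgePair e k eq)) ≡ hV gR (vertexPair (tgt So e) (tgt K' k) (tgt-compatible e k eq))
    tgtG e k eq = trans (sym (h-tgt gR _)) (cong (hV gR) (edgePair-tgt e k eq))

    fromEdgeClass-src : ∀ Tp j b h c e d ed → fromClass Tp h c e ≡ src G (fromEdgeClass Tp j b c e d ed)
    fromEdgeClass-src Tp j b h inContext e nothing ed =
      trans (cong (hV gR) (vertexPair-cong _ _ (sym (sEdge-src Tp j _ _)) refl)) (sym (srcG _ _ _))
    fromEdgeClass-src Tp j b h inContext e (just r') ed =
      trans (cong (hV gR) (vertexPair-cong _ _ (sym (sEdge-src Tp j _ _)) refl)) (sym (srcG _ _ _))
    fromEdgeClass-src Tp j b h (inPattern q') e d ed =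
      trans (cong (hV n) (vertexAt-fun rt q' (proj₂ (proj₂ (proj₂ (classT-inv-fun Tp e (isPos-prefix t Tp [ j ] b))))) _ _))
            (h-src n (rhsEdge Tp j b q' e))
    fromEdgeClass-src Tp j b h (belowVar x R) e d ed =
      trans (cong (hV gR) (vertexPair-cong _ _ (sym (sEdge-src _ j _ _)) (sym (varEdge-src x _ R)))) (sym (srcG _ _ _))

    fromEdgeClass-tgt : ∀ Tp j b c e d ed → fromV (vertexAt t (Tp ++ [ j ]) b) ≡ tgt G (fromEdgeClass Tp j b c e d ed)
    fromEdgeClass-tgt Tp j b inContext e nothing ed =
      trans (fromV-vertexAt _ b inContext (classT-ctx _ ed))
        (trans (cong (hV gR) (vertexPair-cong _ _ (vertexAt-cong s refl _ _) refl)) (sym (tgtG _ _ _)))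
    fromEdgeClass-tgt Tp j b inContext e (just r') ed =
      trans (cong fromV (vertexAt-cong t (trans eqp (sym (++-identityʳ p))) b ht0))
        (trans (fromV-rhs [] tt ht0) (sym (trans (tgtG _ _ _) (gR-root _ (vertexPair-p₂ _ _ _)))))
      where
        eqp = stripPrefix-enter p Tp j (classT-inv-ctx Tp e) ed
        ht0 : T (isPos t (p ++ []))
        ht0 = subst (T ∘ isPos t) (sym (++-identityʳ p)) isPos-t-p
    fromEdgeClass-tgt Tp j b (inPattern q') e d ed =
      trans (cong fromV (vertexAt-cong t eqT b ht'))
        (trans (fromV-rhs (q' ++ [ j ]) (isPos-rhs-child Tp j q' eT er b) ht') (h-tgt n (rhsEdge Tp j b q' e)))
      where
        inv = classT-inv-fun Tp e (isPos-prefix t Tp [ j ] b)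
        eT = proj₁ inv
        er = proj₂ (proj₂ (proj₂ inv))
        eqT : Tp ++ [ j ] ≡ p ++ (q' ++ [ j ])
        eqT = trans (cong (_++ [ j ]) eT) (++-assoc p q' [ j ])
        ht' = subst (T ∘ isPos t) eqT b
    fromEdgeClass-tgt Tp j b (belowVar x R) e d ed =
      trans (fromV-vertexAt _ b (belowVar x (R ++ [ j ])) ec')
        (trans (fromClass-var _ b x (R ++ [ j ]) ec' w ep eu) (sym (tgtG _ _ _)))
      where
        o = proj₂ (classT-inv-var Tp e)
        eT = proj₁ (classT-inv-var Tp e)
        bs = isPos-s-belowVar-child Tp j x o R eT b
        eq = α-varEdge x o R j bs
        w = vertexPair (tgt So (sEdge _ j bs)) (tgt K' (varEdge x o R)) (tgt-compatible _ _ eq)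
        ec' : classT (Tp ++ [ j ]) ≡ belowVar x (R ++ [ j ])
        ec' = trans (cong classT (trans (cong (_++ [ j ]) eT) (++-assoc₃ p (varPos rt x) R j))) (classT-var x o (R ++ [ j ]))
        ep : vertexPos s (hV gL w) ≡ p ++ varPos lt x ++ (R ++ [ j ])
        ep = trans (cong (vertexPos s) (vertexPair-p₁ _ _ _)) (trans (vertexPos-vertexAt s linS _ bs) (++-assoc₃ p (varPos lt x) R j))
        eu : ∀ o' → hV u' w ≡ varNode x o' (R ++ [ j ])
        eu o' = trans (vertexPair-p₂ _ _ _) (trans (varEdge-tgt x o R)
                  (trans (cong (λ z → prm (inj₂ (x , z)) tt) (T-irrelevant o o')) (sym (varNode-snoc x o' R j))))

    fromEdgeClass-lab : ∀ Tp j b c e d ed → num j ≤L lE G (fromEdgeClass Tp j b c e d ed)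
    fromEdgeClass-lab Tp j b inContext e nothing ed = ≤L-trans (edgePair-lab (num j) _ ctxLp _ refl≤ ≤top) (h-lE gR _)
    fromEdgeClass-lab Tp j b inContext e (just r') ed = ≤L-trans (edgePair-lab (num j) _ toRoot _ refl≤ ≤top) (h-lE gR _)
    fromEdgeClass-lab Tp j b (inPattern q') e d ed = h-lE n (rhsEdge Tp j b q' e)
    fromEdgeClass-lab Tp j b (belowVar x R) e d ed = ≤L-trans (edgePair-lab (num j) _ (varEdge x _ R) _ refl≤ (varEdge-top _ x _ R)) (h-lE gR _)

    fromE-src : ∀ (e : TE t) → fromV (src (t °) e) ≡ src G (fromE e)
    fromE-src (Tp , j , a , b) = fromEdgeClass-src Tp j b (vertexPos-isPos t (inj₁ (Tp , a))) (classT Tp) refl (stripPrefix p (Tp ++ [ j ])) refl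

    fromE-tgt : ∀ (e : TE t) → fromV (tgt (t °) e) ≡ tgt G (fromE e)
    fromE-tgt (Tp , j , a , b) = fromEdgeClass-tgt Tp j b (classT Tp) refl (stripPrefix p (Tp ++ [ j ])) refl

    fromE-lab : ∀ (e : TE t) → lE (t °) e ≤L lE G (fromE e)
    fromE-lab (Tp , j , a , b) = fromEdgeClass-lab Tp j b (classT Tp) refl (stripPrefix p (Tp ++ [ j ])) refl

    fromV-lab : ∀ v → lV (t °) v ≤L lV G (fromV v)
    fromV-lab v = ≤L-subst (cong (lV (t °)) (vertexAt-vertexPos t v (vertexPos-isPos t v))) refl
                (fromClass-lab (vertexPos t v) (vertexPos-isPos t v) (classT (vertexPos t v)) refl)

    fromH : Hom (t °) G
    fromH = record { hV = fromV ; hE = fromE ; h-src = fromE-src ; h-tgt = fromE-tgt ; h-lV = fromV-lab ; h-lE = fromE-lab }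

    toU = IsPushout.universal po (t °) q₁ q₂ q-commutes

    toH : Hom G (t °)
    toH = proj₁ toU

    to-gR : (toH ∘H gR) ≈H q₁
    to-gR = proj₁ (proj₂ toU)

    to-n : (toH ∘H n) ≈H q₂
    to-n = proj₁ (proj₂ (proj₂ toU))

    q₁V-vertexAt : ∀ w Tp h → translate (sPos w) ≡ Tp → q₁V w ≡ vertexAt t Tp h
    q₁V-vertexAt w Tp h e = vertexAt-cong t e _ _

    to-fromClass : ∀ Tp h c e → hV toH (fromClass Tp h c e) ≡ vertexAt t Tp h
    to-fromClass Tp h inContext e =
      trans (proj₁ to-gR _)
        (q₁V-vertexAt _ Tp h (trans (cong translate (trans (cong (vertexPos s) (vertexPair-p₁ _ _ _)) (vertexPos-vertexAt s linS Tp _)))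
                              (translate-context Tp (classT-inv-ctx Tp e))))
    to-fromClass Tp h (inPattern q') e =
      trans (proj₁ to-n _)
        (vertexAt-cong t (trans (cong (p ++_) (vertexPos-vertexAt rt linR q' _)) (sym (proj₁ (classT-inv-fun Tp e h)))) _ _)
    to-fromClass Tp h (belowVar x R) e =
      trans (proj₁ to-gR _)
        (q₁V-vertexAt _ Tp h (trans (cong translate (trans (cong (vertexPos s) (vertexPair-p₁ _ _ _)) (vertexPos-vertexAt s linS _ _)))
                       (trans (translate-var x (Rule.vars⊆ ρ x o) R) (sym (proj₁ (classT-inv-var Tp e))))))
      where o = proj₂ (classT-inv-var Tp e)

    to-fromV : ∀ v → hV toH (fromV v) ≡ v
    to-fromV v = trans (to-fromClass (vertexPos t v) (vertexPos-isPos t v) (classT (vertexPos t v)) refl) (vertexAt-vertexPos t v _)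

    q₁Pos-src : ∀ we → q₁Pos (src GK we) ≡ translate (proj₁ (hE gL we))
    q₁Pos-src we = cong translate (sPos-src we)

    to-gR-edge : ∀ we Tp j a b → translate (proj₁ (hE gL we)) ≡ Tp → proj₁ (proj₂ (hE gL we)) ≡ j → hE toH (hE gR we) ≡ (Tp , j , a , b)
    to-gR-edge we Tp j a b e1 e2 = trans (proj₂ to-gR we) (edge-cong t (trans (q₁Pos-src we) e1) e2 _ _ a b)

    to-fromEdgeClass : ∀ Tp j a b c e d ed → hE toH (fromEdgeClass Tp j b c e d ed) ≡ (Tp , j , a , b)
    to-fromEdgeClass Tp j a b inContext e nothing ed =
      to-gR-edge _ Tp j a b (trans (cong (translate ∘ proj₁) (edgePair-p₁ _ _ _)) (translate-context Tp (classT-inv-ctx Tp e)))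
                 (cong (proj₁ ∘ proj₂) (edgePair-p₁ _ _ _))
    to-fromEdgeClass Tp j a b inContext e (just r') ed =
      to-gR-edge _ Tp j a b (trans (cong (translate ∘ proj₁) (edgePair-p₁ _ _ _)) (translate-context Tp (classT-inv-ctx Tp e)))
                 (cong (proj₁ ∘ proj₂) (edgePair-p₁ _ _ _))
    to-fromEdgeClass Tp j a b (inPattern q') e d ed =
      trans (proj₂ to-n _) (edge-cong t (sym (proj₁ (classT-inv-fun Tp e (isPos-prefix t Tp [ j ] b)))) refl _ _ a b)
    to-fromEdgeClass Tp j a b (belowVar x R) e d ed =
      to-gR-edge _ Tp j a b (trans (cong (translate ∘ proj₁) (edgePair-p₁ _ _ _))
                              (trans (translate-var x (Rule.vars⊆ ρ x o) R) (sym (proj₁ (classT-inv-var Tp e)))))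
                 (cong (proj₁ ∘ proj₂) (edgePair-p₁ _ _ _))
      where o = proj₂ (classT-inv-var Tp e)

    to-fromE : ∀ e → hE toH (fromE e) ≡ e
    to-fromE (Tp , j , a , b) = to-fromEdgeClass Tp j a b (classT Tp) refl (stripPrefix p (Tp ++ [ j ])) refl

    to∘from : (toH ∘H fromH) ≈H idH
    to∘from = to-fromV , to-fromE

    from-q₁-belowVar : ∀ w x o R → sPos w ≡ p ++ varPos lt x ++ R → (∀ o' → hV u' w ≡ varNode x o' R) →
                       fromV (q₁V w) ≡ hV gR w
    from-q₁-belowVar w x o R eq eu =
      trans (cong fromV (q₁V-vertexAt w Tp ht (trans (cong translate eq) (translate-var x (Rule.vars⊆ ρ x o) R))))
            (trans (fromV-vertexAt Tp ht (belowVar x R) (classT-var x o R)) (fromClass-var Tp ht x R _ w eq eu))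
      where
        Tp = p ++ varPos rt x ++ R
        ht : T (isPos t Tp)
        ht = subst (T ∘ is-just) (sym (t≈s-below-var x o R)) (subst (T ∘ isPos s) eq (isPos-sPos w))

    from-q₁ : ∀ w → fromV (q₁V w) ≡ hV gR w
    from-q₁ w = go (hV u' w) refl
      where
        go : (k : V K') → hV u' w ≡ k → fromV (q₁V w) ≡ hV gR w
        go ctxV eu = trans (cong fromV (q₁V-vertexAt w (sPos w) ht (translate-context _ d)))
                           (trans (fromV-vertexAt _ ht inContext (classT-ctx _ d)) (fromClass-context _ ht _ w refl eu))
          where
            d = GK-context w eu
            ht : T (isPos t (sPos w))
            ht = shape-isPos t s (sPos w) (sPos w) (t-outside-p (sPos w) d) (isPos-sPos w)
        go (old (inj₁ tt)) eu =
          trans (cong fromV (q₁V-vertexAt w (p ++ []) ht (trans (cong translate (GK-root w eu)) (trans translate-root (sym (++-identityʳ p))))))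
                (trans (fromV-rhs [] tt ht) (sym (gR-root w eu)))
          where
            ht : T (isPos t (p ++ []))
            ht = subst (T ∘ isPos t) (sym (++-identityʳ p)) isPos-t-p
        go (old (inj₂ (x , o))) eu =
          from-q₁-belowVar w x o [] (GK-var w x o eu) (λ o' → trans eu (cong (λ z → old (inj₂ (x , z))) (T-irrelevant o o')))
        go (prm (inj₁ tt) ()) eu
        go (prm (inj₂ (x , o)) o') eu with GK-prm w x o o' eu
        ... | j , R , eq =
          from-q₁-belowVar w x o (j ∷ R) eq
            (λ o₂ → trans eu (cong₂ (λ z₁ z₂ → prm (inj₂ (x , z₁)) z₂) (T-irrelevant o o₂) (T-irrelevant o' tt)))

    from-q₂ : ∀ v → fromV (q₂V v) ≡ hV n v
    from-q₂ v = trans (fromV-rhs (vertexPos rt v) (vertexPos-isPos rt v) _) (cong (hV n) (vertexAt-vertexPos rt v _))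

    fromE-q₂ : ∀ re → fromE (q₂E re) ≡ hE n re
    fromE-q₂ (q' , j , a , b) =
      trans (fromE-edge (p ++ q') j (isFun-intro t (p ++ q') (proj₂ (proj₂ (q₂-fun q' a)))) _ (inPattern q') ec _ refl)
            (cong (hE n) (edge-cong rt refl refl _ _ a b))
      where
        ec = classT-pattern q' (proj₂ (proj₂ (isFun-elim rt q' a)))

    fromE-q₁-via : ∀ we Tp (eT : q₁Pos (src GK we) ≡ Tp) c ec d ed →
                   (∀ b → fromEdgeClass Tp (proj₁ (proj₂ (hE gL we))) b c ec d ed ≡ hE gR we) → fromE (q₁E we) ≡ hE gR we
    fromE-q₁-via we Tp eT c ec d ed k =
      trans (cong fromE (edge-cong t eT refl (proj₁ (proj₂ (proj₂ (q₁E we)))) (q₁-isPos-child we) a b)) (trans (fromE-edge Tp j a b c ec d ed) (k b))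
      where
        j = proj₁ (proj₂ (hE gL we))
        b = subst (λ z → T (isPos t (z ++ [ j ]))) eT (q₁-isPos-child we)
        a = isFun-intro t Tp (proj₂ (proj₂ (parent-is-fun t Tp j b)))

    fromE-q₁-belowVar : ∀ we x o R → proj₁ (hE gL we) ≡ p ++ varPos lt x ++ R → (∀ o' → hE u' we ≡ varEdge x o' R) →
                        fromE (q₁E we) ≡ hE gR we
    fromE-q₁-belowVar we x o R eQ eu =
      fromE-q₁-via we Tp eT (belowVar x R) (classT-var x o R) _ refl
        (λ _ → cong (hE gR) (sym (edgePair-unique _ _ _ we (edge-cong s eQ refl _ _ _ _) (eu _))))
      where
        Tp = p ++ varPos rt x ++ R
        eT = trans (q₁Pos-src we) (trans (cong translate eQ) (translate-var x (Rule.vars⊆ ρ x o) R))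

    fromE-q₁ : ∀ we → fromE (q₁E we) ≡ hE gR we
    fromE-q₁ we = go (hE u' we) refl
      where
        Q = proj₁ (hE gL we)
        j = proj₁ (proj₂ (hE gL we))
        Q≡ : sPos (src GK we) ≡ Q
        Q≡ = sPos-src we
        Qj≡ : sPos (tgt GK we) ≡ Q ++ [ j ]
        Qj≡ = trans (sPos-tgt we) (cong (_++ [ j ]) Q≡)
        u'-src : ∀ {ke} → hE u' we ≡ ke → hV u' (src GK we) ≡ src K' ke
        u'-src eu = trans (h-src u' we) (cong (src K') eu)
        u'-tgt : ∀ {ke} → hE u' we ≡ ke → hV u' (tgt GK we) ≡ tgt K' ke
        u'-tgt eu = trans (h-tgt u' we) (cong (tgt K') eu)
        outside : ∀ {ke} → hE u' we ≡ ke → src K' ke ≡ ctxV → stripPrefix p Q ≡ nothing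
        outside eu c = subst (λ z → stripPrefix p z ≡ nothing) Q≡ (GK-context (src GK we) (trans (u'-src eu) c))
        sEdge-pair : ∀ {ke} → hE u' we ≡ ke → ∀ b eq → hE gR (edgePair (sEdge Q j b) ke eq) ≡ hE gR we
        sEdge-pair eu b eq = cong (hE gR) (sym (edgePair-unique _ _ _ we (edge-cong s refl refl _ _ _ _) eu))
        go : (ke : E K') → hE u' we ≡ ke → fromE (q₁E we) ≡ hE gR we
        go (oldE ()) eu
        go (toPrm (inj₁ tt) ()) eu
        go (prmLp (inj₁ tt) ()) eu
        go ctxLp eu =
          fromE-q₁-via we Q (trans (q₁Pos-src we) (translate-context Q dQ)) inContext (classT-ctx Q dQ) nothing dQj
            (λ _ → sEdge-pair eu _ _)
          where
            dQ = outside eu refl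
            dQj = subst (λ z → stripPrefix p z ≡ nothing) Qj≡ (GK-context (tgt GK we) (u'-tgt eu))
        go toRoot eu =
          fromE-q₁-via we Q (trans (q₁Pos-src we) (translate-context Q dQ)) inContext (classT-ctx Q dQ) (just []) dJ
            (λ _ → sEdge-pair eu _ _)
          where
            dQ = outside eu refl
            dJ = trans (cong (stripPrefix p) (trans (sym Qj≡) (GK-root (tgt GK we) (u'-tgt eu)))) (stripPrefix-self p)
        go (toPrm (inj₂ (x , o)) o') eu =
          fromE-q₁-belowVar we x o [] (trans (sym Q≡) (GK-var (src GK we) x o (u'-src eu)))
            (λ o₂ → trans eu (cong₂ (λ z₁ z₂ → toPrm (inj₂ (x , z₁)) z₂) (T-irrelevant o o₂) (T-irrelevant o' tt)))
        go (prmLp (inj₂ (x , o)) o') eu with GK-prm (src GK we) x o o' (u'-src eu)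
        ... | j' , R , eq =
          fromE-q₁-belowVar we x o (j' ∷ R) (trans (sym Q≡) eq)
            (λ o₂ → trans eu (cong₂ (λ z₁ z₂ → prmLp (inj₂ (x , z₁)) z₂) (T-irrelevant o o₂) (T-irrelevant o' tt)))

    fromH∘toH∘gR : ((fromH ∘H toH) ∘H gR) ≈H gR
    fromH∘toH∘gR = (λ w → trans (cong fromV (proj₁ to-gR w)) (from-q₁ w)) , (λ we → trans (cong fromE (proj₂ to-gR we)) (fromE-q₁ we))

    fromH∘toH∘n : ((fromH ∘H toH) ∘H n) ≈H n
    fromH∘toH∘n = (λ v → trans (cong fromV (proj₁ to-n v)) (from-q₂ v)) , (λ re → trans (cong fromE (proj₂ to-n re)) (fromE-q₂ re))

lemma34 : (S : Signature) → let open TRS S in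
    (ρ : Rule) → Linear (Rule.lhs ρ) → Linear (Rule.rhs ρ) →
    (s : Term) → Linear s → (G : Graph) →
    Step (ρ °R) (s °) G →
    Σ Term λ t → (s ⟶[ ρ ] t) × (G ≅ (t °))
lemma34 S ρ linL linR s linS G st =
  t , s⟶t , pushout-≅ (Step.po st) toH fromH to∘from fromH∘toH∘gR fromH∘toH∘n
  where
    open TRS S using (module Step)
    open Graphs S using (pushout-≅)
    open Lemma34.Analysis S ρ linL linR s linS G st
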